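{- Let $n\ge 0$. For every integer $k$ with $0\leq k\leq \lfloor\frac{n-3}{2}\rfloor$, the vector \[ \mathbf{P}_k := - (n-2k-1)(n-2k-2) \mathbf{Z}_{n-k} + \sum_{i=k+1}^{n-k-1} \Big[ 2(i-k-1)\mathbf{Z}_i+(2i-n)(\mathbf{X}_i+\mathbf{Y}_i) \Big] \] is a nonzero eigenvector of the adjacency matrix $A$ of $\mathrm{SR}(3,n)$ with eigenvalue $k-2$. Moreover, the linear span of the $\mathfrak{S}_3$-orbit $\{\tau(\mathbf{P}_k):\tau\in\mathfrak{S}_3\}$ has dimension $3$.
   Context: $\mathrm{SR}(3,n)$ has vertex set $V(3,n)=\{(i,j,k)\in\mathbb{Z}_{\ge 0}^3: i+j+k=n\}$, two vertices adjacent if they differ in exactly two coordinates; $A$ acts on $\mathbb{R}^N$, $N=\binom{n+2}{2}$, with standard basis $\{\mathbf{e}_{ijk}\}$, via $A\mathbf{e}_x=\sum_{y\sim x}\mathbf{e}_y$. For $0\le i\le n$: $\mathbf{X}_i=\sum_{j+k=n-i}\mathbf{e}_{ijk}$, $\mathbf{Y}_i=\sum_{a+k=n-i}\mathbf{e}_{aik}$, $\mathbf{Z}_i=\sum_{a+b=n-i}\mathbf{e}_{abi}$. The symmetric group $\mathfrak{S}_3$ acts on $V(3,n)$ by permuting coordinates and hence linearly on $\mathbb{R}^N$ by permuting basis vectors accordingly (so it permutes the families $\mathbf{X},\mathbf{Y},\mathbf{Z}$, e.g. the 3-cycle maps $\mathbf{X}_i\mapsto\mathbf{Y}_i\mapst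o\mathbf{Z}_i\mapsto\mathbf{X}_i$).
   Formalization: The adjacency matrix A acts on vectors with rational entries rather than on $\mathbb{R}^N$, and the linear span of the orbit is taken over ℚ. -}

module Defs where

open import Data.Nat as ℕ using (ℕ; zero; suc; _≡ᵇ_)
open import Data.Nat.Properties using (+-comm; +-assoc; +-suc)
open import Data.Integer as ℤ using (ℤ; +_)
open import Data.Rational using (ℚ; 0ℚ; 1ℚ; _+_; _*_; _-_; -_; _/_)
open import Data.Fin using (Fin)
open import Data.List using (List; []; _∷_; map; foldr; _++_; upTo; allFin)
open import Data.Bool using (Bool; true; false; if_then_else_)
open import Data.Product using (Σ; _×_; _,_)
open import Relation.Binary.PropositionalEquality using (_≡_; refl; cong; trans; sym)

record Vertex (n : ℕ) : Set where
  constructor vtx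
  field
    i j k : ℕ
    sum≡  : i ℕ.+ j ℕ.+ k ≡ n

open Vertex public

-- Explicit enumeration of V(3,n) (each vertex exactly once).
-- pairs m lists all (j , k) with j + k = m.
pairs : (m : ℕ) → List (Σ ℕ λ j → Σ ℕ λ k → j ℕ.+ k ≡ m)
pairs zero    = (0 , 0 , refl) ∷ []
pairs (suc m) = (0 , suc m , refl) ∷ map (λ { (j , k , p) → (suc j , k , cong suc p) }) (pairs m)

vertices : (n : ℕ) → List (Vertex n)
vertices zero    = vtx 0 0 0 refl ∷ []
vertices (suc n) =
  map (λ { (j , k , p) → vtx 0 j k p }) (pairs (suc n))
  ++ map (λ { (vtx i j k p) → vtx (suc i) j k (cong suc p) }) (vertices n)

-- Vectors of ℝ^N (here with rational entries): functions V(3,n) → ℚ.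
Vect : ℕ → Set
Vect n = Vertex n → ℚ

_≈_ : ∀ {n} → Vect n → Vect n → Set
u ≈ v = ∀ x → u x ≡ v x

0V : ∀ {n} → Vect n
0V _ = 0ℚ

_+V_ : ∀ {n} → Vect n → Vect n → Vect n
(u +V v) x = u x + v x

_·V_ : ∀ {n} → ℚ → Vect n → Vect n
(c ·V v) x = c * v x

sumℚ : List ℚ → ℚ
sumℚ = foldr _+_ 0ℚ

sumV : ∀ {n} → List (Vect n) → Vect n
sumV = foldr _+V_ 0V

ℕ→ℚ : ℕ → ℚ
ℕ→ℚ m = + m / 1

ℤ→ℚ : ℤ → ℚ
ℤ→ℚ z = z / 1

neq : ℕ → ℕ → ℕ
neq a b = if a ≡ᵇ b then 0 else 1

diffCount : ∀ {n} → Vertex n → Vertex n → ℕ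
diffCount x y = neq (i x) (i y) ℕ.+ neq (j x) (j y) ℕ.+ neq (k x) (k y)

adjacentᵇ : ∀ {n} → Vertex n → Vertex n → Bool
adjacentᵇ x y = diffCount x y ≡ᵇ 2

-- The adjacency operator A:  A e_x = Σ_{y ~ x} e_y, i.e. (A v)(y) = Σ_{x ~ y} v(x).
A : ∀ {n} → Vect n → Vect n
A {n} v y = sumℚ (map (λ x → if adjacentᵇ x y then v x else 0ℚ) (vertices n))

ind : Bool → ℚ
ind b = if b then 1ℚ else 0ℚ

X Y Z : ∀ {n} → ℕ → Vect n
X a x = ind (i x ≡ᵇ a)
Y a x = ind (j x ≡ᵇ a)
Z a x = ind (k x ≡ᵇ a)

-- the list [a, a+1, ..., b] (empty if b < a)
range : ℕ → ℕ → List ℕ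
range a b = map (a ℕ.+_) (upTo (suc b ℕ.∸ a))

P : (n k : ℕ) → Vect n
P n k =
  ((- ℕ→ℚ ((n ℕ.∸ 2 ℕ.* k ℕ.∸ 1) ℕ.* (n ℕ.∸ 2 ℕ.* k ℕ.∸ 2))) ·V Z (n ℕ.∸ k))
  +V sumV (map (λ a →
        (ℕ→ℚ (2 ℕ.* (a ℕ.∸ k ℕ.∸ 1)) ·V Z a)
     +V (ℤ→ℚ (+ (2 ℕ.* a) ℤ.- + n) ·V (X a +V Y a)))
     (range (suc k) (n ℕ.∸ k ℕ.∸ 1)))

data S₃ : Set where
  e s₁₂ s₁₃ s₂₃ c₁₂₃ c₁₃₂ : S₃

private
  lem-jik : ∀ a b c → b ℕ.+ a ℕ.+ c ≡ a ℕ.+ b ℕ.+ c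
  lem-jik a b c = cong (ℕ._+ c) (+-comm b a)
  lem-acb : ∀ a b c → a ℕ.+ c ℕ.+ b ≡ a ℕ.+ b ℕ.+ c
  lem-acb a b c = trans (+-assoc a c b) (trans (cong (a ℕ.+_) (+-comm c b)) (sym (+-assoc a b c)))
  lem-cba : ∀ a b c → c ℕ.+ b ℕ.+ a ≡ a ℕ.+ b ℕ.+ c
  lem-cba a b c = trans (+-comm (c ℕ.+ b) a) (trans (sym (+-assoc a c b)) (lem-acb a b c))
  lem-bca : ∀ a b c → b ℕ.+ c ℕ.+ a ≡ a ℕ.+ b ℕ.+ c
  lem-bca a b c = trans (+-comm (b ℕ.+ c) a) (sym (+-assoc a b c))
  lem-cab : ∀ a b c → c ℕ.+ a ℕ.+ b ≡ a ℕ.+ b ℕ.+ c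
  lem-cab a b c = trans (+-assoc c a b) (+-comm c (a ℕ.+ b))

-- action of τ on vertices by permuting coordinates:
-- s₁₂ swaps coordinates 1,2; c₁₂₃ moves the entry in position 1 to position 2,
-- 2 to 3, 3 to 1 (so that it maps X_i ↦ Y_i ↦ Z_i ↦ X_i on vectors).
act : ∀ {n} → S₃ → Vertex n → Vertex n
act e    x = x
act s₁₂  (vtx a b c p) = vtx b a c (trans (lem-jik a b c) p)
act s₁₃  (vtx a b c p) = vtx c b a (trans (lem-cba a b c) p)
act s₂₃  (vtx a b c p) = vtx a c b (trans (lem-acb a b c) p)
act c₁₂₃ (vtx a b c p) = vtx c a b (trans (lem-cab a b c) p)
act c₁₃₂ (vtx a b c p) = vtx b c a (trans (lem-bca a b c) p)

inv : S₃ → S₃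
inv e = e
inv s₁₂ = s₁₂
inv s₁₃ = s₁₃
inv s₂₃ = s₂₃
inv c₁₂₃ = c₁₃₂
inv c₁₃₂ = c₁₂₃

-- induced linear action on vectors (permuting basis vectors): τ(e_x) = e_{τ x}
actV : ∀ {n} → S₃ → Vect n → Vect n
actV τ v x = v (act (inv τ) x)

lincomb : ∀ {n d} → (Fin d → ℚ) → (Fin d → Vect n) → Vect n
lincomb {d = d} c B x = sumℚ (map (λ r → c r * B r x) (allFin d))

LinIndep : ∀ {n d} → (Fin d → Vect n) → Set
LinIndep {d = d} B = ∀ (c : Fin d → ℚ) → lincomb c B ≈ 0V → ∀ r → c r ≡ 0ℚ

InSpan : ∀ {n d} → Vect n → (Fin d → Vect n) → Set
InSpan {d = d} v B = Σ (Fin d → ℚ) λ c → v ≈ lincomb c B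

-- The linear span of the family (F τ)_{τ ∈ S₃} has dimension d:
-- it has a basis B of d vectors, i.e. B lies in span F, B is linearly
-- independent and every F τ lies in span B.
InSpanS₃ : ∀ {n} → Vect n → (S₃ → Vect n) → Set
InSpanS₃ v F = Σ (S₃ → ℚ) λ c → v ≈ sumV (map (λ τ → c τ ·V F τ) (e ∷ s₁₂ ∷ s₁₃ ∷ s₂₃ ∷ c₁₂₃ ∷ c₁₃₂ ∷ []))

SpanDimS₃ : ∀ {n} → (S₃ → Vect n) → ℕ → Set
SpanDimS₃ {n} F d = Σ (Fin d → Vect n) λ B →
  (∀ r → InSpanS₃ (B r) F) × LinIndep B × (∀ τ → InSpan (F τ) B)

-- P_κ is separable: P_κ(a,b,c) = f a + f b + g c, where f and g are the coefficients of X_t and of Z_t.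
-- Two vertices of the plane a + b + c = n are adjacent exactly when they agree in one coordinate, so
-- (A v)(y) is the sum of v over the three lines through y minus 3 v(y). For separable v these line sums
-- are expressed through the partial sums F, G of f and g, and v is an eigenvector for μ − 2 as soon as
-- F(n−t) + G(n−t) + (n−t−μ) f(t) = 0 and 2 F(n−t) + (n−t−μ) g(t) = 0 for every t ≤ n. For P_κ with
-- n = 2κ+3+d, f and g are piecewise linear, F and G piecewise quadratic, and both identities hold with
-- μ = κ. Finally P_κ is symmetric in the first two coordinates, so its S₃-orbit is {P_κ, s₁₃P_κ, s₂₃P_κ};
-- these are independent since at the vertex (0, κ, n−κ) and its two images only one of them is nonzero.

module Submission where

open import Defs
open import Data.Bool using (true; false; if_then_else_; T; _∧_)
open import Data.Empty using (⊥-elim)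
open import Data.Fin using (Fin; zero; suc; toℕ)
import Data.Fin.Properties as Fin
open import Data.Integer as ℤ using (ℤ)
import Data.Integer.Properties as ℤ
open import Data.List using (List; []; _∷_; map; _++_; upTo; applyUpTo)
import Data.List.Properties as List
open import Data.Nat as ℕ using (ℕ; zero; suc; _∸_; _≤_; _<_; _≡ᵇ_; z≤n; s≤s)
import Data.Nat.Properties as ℕ
open import Data.Product using (Σ; _×_; _,_; proj₁; proj₂)
open import Data.Rational using (ℚ; 0ℚ; 1ℚ; _+_; _*_; _-_; -_; 1/_; toℚᵘ; ≢-nonZero)
import Data.Rational.Properties as ℚ
import Data.Rational.Unnormalised as ℚᵘ
import Data.Rational.Unnormalised.Properties as ℚᵘ
open import Data.Rational.Solver using (module +-*-Solver)
open import Data.Nat.Tactic.RingSolver using (solve-∀)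
open import Function using (_∘_)
open import Relation.Binary.PropositionalEquality
open import Relation.Nullary using (¬_; yes; no)

open +-*-Solver

ℤ→ℚ-toℚᵘ : ∀ z → toℚᵘ (ℤ→ℚ z) ℚᵘ.≃ ℚᵘ.mkℚᵘ z 0
ℤ→ℚ-toℚᵘ z = ℚ.toℚᵘ-fromℚᵘ (ℚᵘ.mkℚᵘ z 0)

ℤ→ℚ-+ : ∀ a b → ℤ→ℚ (a ℤ.+ b) ≡ ℤ→ℚ a + ℤ→ℚ b
ℤ→ℚ-+ a b = ℚ.toℚᵘ-injective (begin
  toℚᵘ (ℤ→ℚ (a ℤ.+ b))          ≈⟨ ℤ→ℚ-toℚᵘ (a ℤ.+ b) ⟩
  ℚᵘ.mkℚᵘ (a ℤ.+ b) 0           ≈⟨ ℚᵘ.*≡* (cong₂ (λ x y → (x ℤ.+ y) ℤ.* ℤ.+ 1) (sym (ℤ.*-identityʳ a)) (sym (ℤ.*-identityʳ b))) ⟩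
  ℚᵘ.mkℚᵘ a 0 ℚᵘ.+ ℚᵘ.mkℚᵘ b 0  ≈⟨ ℚᵘ.+-cong (ℚᵘ.≃-sym (ℤ→ℚ-toℚᵘ a)) (ℚᵘ.≃-sym (ℤ→ℚ-toℚᵘ b)) ⟩
  toℚᵘ (ℤ→ℚ a) ℚᵘ.+ toℚᵘ (ℤ→ℚ b) ≈⟨ ℚᵘ.≃-sym (ℚ.toℚᵘ-homo-+ (ℤ→ℚ a) (ℤ→ℚ b)) ⟩
  toℚᵘ (ℤ→ℚ a + ℤ→ℚ b)          ∎)
  where open ℚᵘ.≃-Reasoning

ℤ→ℚ-* : ∀ a b → ℤ→ℚ (a ℤ.* b) ≡ ℤ→ℚ a * ℤ→ℚ b
ℤ→ℚ-* a b = ℚ.toℚᵘ-injective (begin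
  toℚᵘ (ℤ→ℚ (a ℤ.* b))          ≈⟨ ℤ→ℚ-toℚᵘ (a ℤ.* b) ⟩
  ℚᵘ.mkℚᵘ a 0 ℚᵘ.* ℚᵘ.mkℚᵘ b 0  ≈⟨ ℚᵘ.*-cong (ℚᵘ.≃-sym (ℤ→ℚ-toℚᵘ a)) (ℚᵘ.≃-sym (ℤ→ℚ-toℚᵘ b)) ⟩
  toℚᵘ (ℤ→ℚ a) ℚᵘ.* toℚᵘ (ℤ→ℚ b) ≈⟨ ℚᵘ.≃-sym (ℚ.toℚᵘ-homo-* (ℤ→ℚ a) (ℤ→ℚ b)) ⟩
  toℚᵘ (ℤ→ℚ a * ℤ→ℚ b)          ∎)
  where open ℚᵘ.≃-Reasoning

ℤ→ℚ-neg : ∀ a → ℤ→ℚ (ℤ.- a) ≡ - ℤ→ℚ a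
ℤ→ℚ-neg a = ℚ.toℚᵘ-injective (begin
  toℚᵘ (ℤ→ℚ (ℤ.- a))    ≈⟨ ℤ→ℚ-toℚᵘ (ℤ.- a) ⟩
  ℚᵘ.- ℚᵘ.mkℚᵘ a 0     ≈⟨ ℚᵘ.-‿cong (ℚᵘ.≃-sym (ℤ→ℚ-toℚᵘ a)) ⟩
  ℚᵘ.- toℚᵘ (ℤ→ℚ a)    ≈⟨ ℚᵘ.≃-sym (ℚ.toℚᵘ-homo‿- (ℤ→ℚ a)) ⟩
  toℚᵘ (- ℤ→ℚ a)       ∎)
  where open ℚᵘ.≃-Reasoning

ℤ→ℚ-- : ∀ a b → ℤ→ℚ (a ℤ.- b) ≡ ℤ→ℚ a - ℤ→ℚ b
ℤ→ℚ-- a b = trans (ℤ→ℚ-+ a (ℤ.- b)) (cong (λ x → ℤ→ℚ a + x) (ℤ→ℚ-neg b))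

ℤ→ℚ-injective : ∀ {a b} → ℤ→ℚ a ≡ ℤ→ℚ b → a ≡ b
ℤ→ℚ-injective {a} {b} eq with ℚᵘ.≃-trans (ℚᵘ.≃-sym (ℤ→ℚ-toℚᵘ a)) (ℚᵘ.≃-trans (ℚᵘ.≃-reflexive (cong toℚᵘ eq)) (ℤ→ℚ-toℚᵘ b))
... | ℚᵘ.*≡* a*1≡b*1 = trans (sym (ℤ.*-identityʳ a)) (trans a*1≡b*1 (ℤ.*-identityʳ b))

ℕ→ℚ-+ : ∀ a b → ℕ→ℚ (a ℕ.+ b) ≡ ℕ→ℚ a + ℕ→ℚ b
ℕ→ℚ-+ a b = ℤ→ℚ-+ (ℤ.+ a) (ℤ.+ b)

ℕ→ℚ-* : ∀ a b → ℕ→ℚ (a ℕ.* b) ≡ ℕ→ℚ a * ℕ→ℚ b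
ℕ→ℚ-* a b = trans (cong ℤ→ℚ (ℤ.pos-* a b)) (ℤ→ℚ-* (ℤ.+ a) (ℤ.+ b))

ℕ→ℚ-suc : ∀ m → ℕ→ℚ (suc m) ≡ 1ℚ + ℕ→ℚ m
ℕ→ℚ-suc m = ℕ→ℚ-+ 1 m

ℕ→ℚ-≢0 : ∀ {m} → m ≢ 0 → ℕ→ℚ m ≢ 0ℚ
ℕ→ℚ-≢0 {m} m≢0 eq = m≢0 (ℤ.+-injective (ℤ→ℚ-injective {ℤ.+ m} {ℤ.+ 0} eq))

ℕ→ℚ-difference : ∀ a b c m → a ℕ.+ c ≡ b ℕ.+ m → ℕ→ℚ a - ℕ→ℚ b ≡ ℕ→ℚ m - ℕ→ℚ c
ℕ→ℚ-difference a b c m a+c≡b+m = begin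
  ℕ→ℚ a - ℕ→ℚ b                              ≡⟨ solve 3 (λ a b c → a :- b := (a :+ c) :- (b :+ c)) refl (ℕ→ℚ a) (ℕ→ℚ b) (ℕ→ℚ c) ⟩
  (ℕ→ℚ a + ℕ→ℚ c) - (ℕ→ℚ b + ℕ→ℚ c)          ≡⟨ cong (_- (ℕ→ℚ b + ℕ→ℚ c)) sums ⟩
  (ℕ→ℚ b + ℕ→ℚ m) - (ℕ→ℚ b + ℕ→ℚ c)          ≡⟨ solve 3 (λ b c m → (b :+ m) :- (b :+ c) := m :- c) refl (ℕ→ℚ b) (ℕ→ℚ c) (ℕ→ℚ m) ⟩
  ℕ→ℚ m - ℕ→ℚ c                              ∎
  where
  open ≡-Reasoning
  sums : ℕ→ℚ a + ℕ→ℚ c ≡ ℕ→ℚ b + ℕ→ℚ m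
  sums = trans (sym (ℕ→ℚ-+ a c)) (trans (cong ℕ→ℚ a+c≡b+m) (ℕ→ℚ-+ b m))

∑ : ℕ → (ℕ → ℚ) → ℚ
∑ zero    ψ = 0ℚ
∑ (suc L) ψ = ∑ L ψ + ψ L

syntax ∑ L (λ u → e) = ∑[ u < L ] e

∑-cong : ∀ {ψ χ} L → (∀ u → u < L → ψ u ≡ χ u) → ∑ L ψ ≡ ∑ L χ
∑-cong zero    eq = refl
∑-cong (suc L) eq = cong₂ _+_ (∑-cong L (λ u u<L → eq u (ℕ.m<n⇒m<1+n u<L))) (eq L ℕ.≤-refl)

∑-zero : ∀ ψ L → (∀ u → u < L → ψ u ≡ 0ℚ) → ∑ L ψ ≡ 0ℚ
∑-zero ψ zero    eq = refl
∑-zero ψ (suc L) eq = cong₂ _+_ (∑-zero ψ L (λ u u<L → eq u (ℕ.m<n⇒m<1+n u<L))) (eq L ℕ.≤-refl)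

∑-single : ∀ ψ L {u₀} → u₀ < L → (∀ u → u < L → u ≢ u₀ → ψ u ≡ 0ℚ) → ∑ L ψ ≡ ψ u₀
∑-single ψ (suc L) {u₀} u₀<L others with u₀ ℕ.≟ L
... | yes refl = trans (cong (_+ ψ u₀) (∑-zero ψ L (λ u u<L → others u (ℕ.m<n⇒m<1+n u<L) (ℕ.<⇒≢ u<L))))
                       (ℚ.+-identityˡ (ψ u₀))
... | no u₀≢L  = trans (cong₂ _+_ (∑-single ψ L (ℕ.≤∧≢⇒< (ℕ.≤-pred u₀<L) u₀≢L) (λ u u<L → others u (ℕ.m<n⇒m<1+n u<L)))
                                  (others L ℕ.≤-refl (u₀≢L ∘ sym)))
                       (ℚ.+-identityʳ (ψ u₀))

∑-+ : ∀ ψ χ L → ∑[ u < L ] (ψ u + χ u) ≡ ∑ L ψ + ∑ L χ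
∑-+ ψ χ zero    = refl
∑-+ ψ χ (suc L) = trans (cong (_+ (ψ L + χ L)) (∑-+ ψ χ L))
  (solve 4 (λ a b c d → (a :+ b) :+ (c :+ d) := (a :+ c) :+ (b :+ d)) refl (∑ L ψ) (∑ L χ) (ψ L) (χ L))

∑-*ˡ : ∀ c ψ L → ∑[ u < L ] (c * ψ u) ≡ c * ∑ L ψ
∑-*ˡ c ψ zero    = sym (ℚ.*-zeroʳ c)
∑-*ˡ c ψ (suc L) = trans (cong (_+ c * ψ L) (∑-*ˡ c ψ L)) (sym (ℚ.*-distribˡ-+ c (∑ L ψ) (ψ L)))

∑-const : ∀ c L → ∑[ _ < L ] c ≡ ℕ→ℚ L * c
∑-const c zero    = sym (ℚ.*-zeroˡ c)
∑-const c (suc L) = begin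
  ∑[ _ < L ] c + c       ≡⟨ cong (_+ c) (∑-const c L) ⟩
  ℕ→ℚ L * c + c          ≡⟨ solve 2 (λ x c → x :* c :+ c := (con 1ℚ :+ x) :* c) refl (ℕ→ℚ L) c ⟩
  (1ℚ + ℕ→ℚ L) * c       ≡⟨ cong (_* c) (sym (ℕ→ℚ-suc L)) ⟩
  ℕ→ℚ (suc L) * c        ∎
  where open ≡-Reasoning

∑-split : ∀ ψ M E → ∑ (M ℕ.+ E) ψ ≡ ∑ M ψ + ∑[ u < E ] ψ (M ℕ.+ u)
∑-split ψ M zero    = trans (cong (λ L → ∑ L ψ) (ℕ.+-identityʳ M)) (sym (ℚ.+-identityʳ (∑ M ψ)))
∑-split ψ M (suc E) = trans (cong (λ L → ∑ L ψ) (ℕ.+-suc M E))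
  (trans (cong (_+ ψ (M ℕ.+ E)) (∑-split ψ M E)) (ℚ.+-assoc (∑ M ψ) _ (ψ (M ℕ.+ E))))

∑-truncate : ∀ ψ {M L} → M ≤ L → (∀ u → M ≤ u → u < L → ψ u ≡ 0ℚ) → ∑ L ψ ≡ ∑ M ψ
∑-truncate ψ {M} {L} M≤L tail = begin
  ∑ L ψ                                 ≡⟨ cong (λ L → ∑ L ψ) (sym (ℕ.m+[n∸m]≡n M≤L)) ⟩
  ∑ (M ℕ.+ (L ∸ M)) ψ                   ≡⟨ ∑-split ψ M (L ∸ M) ⟩
  ∑ M ψ + ∑[ u < L ∸ M ] ψ (M ℕ.+ u)    ≡⟨ cong (∑ M ψ +_) (∑-zero _ _ (λ u u< → tail (M ℕ.+ u) (ℕ.m≤m+n M u)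
                                              (subst (M ℕ.+ u <_) (ℕ.m+[n∸m]≡n M≤L) (ℕ.+-monoʳ-< M u<)))) ⟩
  ∑ M ψ + 0ℚ                            ≡⟨ ℚ.+-identityʳ (∑ M ψ) ⟩
  ∑ M ψ                                 ∎
  where open ≡-Reasoning

∑-front : ∀ ψ L → ∑ (suc L) ψ ≡ ψ 0 + ∑[ u < L ] ψ (suc u)
∑-front ψ zero    = trans (ℚ.+-identityˡ (ψ 0)) (sym (ℚ.+-identityʳ (ψ 0)))
∑-front ψ (suc L) = trans (cong (_+ ψ (suc L)) (∑-front ψ L)) (ℚ.+-assoc (ψ 0) _ (ψ (suc L)))

∑-reverse : ∀ ψ m → ∑ (suc m) ψ ≡ ∑[ b < suc m ] ψ (m ∸ b)
∑-reverse ψ zero    = refl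
∑-reverse ψ (suc m) = begin
  ∑ (suc m) ψ + ψ (suc m)                        ≡⟨ cong (_+ ψ (suc m)) (∑-reverse ψ m) ⟩
  ∑[ b < suc m ] ψ (m ∸ b) + ψ (suc m)           ≡⟨ ℚ.+-comm _ (ψ (suc m)) ⟩
  ψ (suc m) + ∑[ b < suc m ] ψ (m ∸ b)           ≡⟨ sym (∑-front (λ b → ψ (suc m ∸ b)) (suc m)) ⟩
  ∑[ b < suc (suc m) ] ψ (suc m ∸ b)             ∎
  where open ≡-Reasoning

sumℚ-++ : ∀ xs ys → sumℚ (xs ++ ys) ≡ sumℚ xs + sumℚ ys
sumℚ-++ []       ys = sym (ℚ.+-identityˡ (sumℚ ys))
sumℚ-++ (x ∷ xs) ys = trans (cong (x +_) (sumℚ-++ xs ys)) (sym (ℚ.+-assoc x (sumℚ xs) (sumℚ ys)))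

sumℚ-map-∘ : ∀ {A B : Set} (φ : B → ℚ) (g : A → B) xs → sumℚ (map φ (map g xs)) ≡ sumℚ (map (φ ∘ g) xs)
sumℚ-map-∘ φ g xs = cong sumℚ (sym (List.map-∘ xs))

sumℚ-map-cong : ∀ {A : Set} {φ χ : A → ℚ} → (∀ a → φ a ≡ χ a) → ∀ xs → sumℚ (map φ xs) ≡ sumℚ (map χ xs)
sumℚ-map-cong eq xs = cong sumℚ (List.map-cong eq xs)

sumℚ-map-+ : ∀ {A : Set} (φ χ : A → ℚ) xs → sumℚ (map (λ a → φ a + χ a) xs) ≡ sumℚ (map φ xs) + sumℚ (map χ xs)
sumℚ-map-+ φ χ []       = refl
sumℚ-map-+ φ χ (x ∷ xs) = trans (cong (φ x + χ x +_) (sumℚ-map-+ φ χ xs))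
  (solve 4 (λ a b c d → (a :+ b) :+ (c :+ d) := (a :+ c) :+ (b :+ d)) refl (φ x) (χ x) _ _)

sumℚ-map-*ˡ : ∀ {A : Set} c (φ : A → ℚ) xs → sumℚ (map (λ a → c * φ a) xs) ≡ c * sumℚ (map φ xs)
sumℚ-map-*ˡ c φ []       = sym (ℚ.*-zeroʳ c)
sumℚ-map-*ˡ c φ (x ∷ xs) = trans (cong (c * φ x +_) (sumℚ-map-*ˡ c φ xs)) (sym (ℚ.*-distribˡ-+ c (φ x) _))

sumℚ-applyUpTo : ∀ g L → sumℚ (applyUpTo g L) ≡ ∑ L g
sumℚ-applyUpTo g zero    = refl
sumℚ-applyUpTo g (suc L) = trans (cong (g 0 +_) (sumℚ-applyUpTo (g ∘ suc) L)) (sym (∑-front g L))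

sumℚ-range : ∀ (φ : ℕ → ℚ) s L → sumℚ (map φ (map (s ℕ.+_) (upTo L))) ≡ ∑[ u < L ] φ (s ℕ.+ u)
sumℚ-range φ s L = trans (sumℚ-map-∘ φ (s ℕ.+_) (upTo L))
  (trans (cong sumℚ (List.map-upTo (φ ∘ (s ℕ.+_)) L)) (sumℚ-applyUpTo (φ ∘ (s ℕ.+_)) L))

sumV-apply : ∀ {n} (vs : List (Vect n)) x → sumV vs x ≡ sumℚ (map (λ v → v x) vs)
sumV-apply []       x = refl
sumV-apply (v ∷ vs) x = cong (v x +_) (sumV-apply vs x)

byCoords : ∀ {n} → (ℕ → ℕ → ℕ → ℚ) → Vect n
byCoords h x = h (i x) (j x) (k x)

sum-pairs : ∀ m (Ψ : ℕ → ℕ → ℚ) →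
  sumℚ (map (λ t → Ψ (proj₁ t) (proj₁ (proj₂ t))) (pairs m)) ≡ ∑[ b < suc m ] Ψ b (m ∸ b)
sum-pairs zero    Ψ = trans (ℚ.+-identityʳ (Ψ 0 0)) (sym (ℚ.+-identityˡ (Ψ 0 0)))
sum-pairs (suc m) Ψ = trans (cong (Ψ 0 (suc m) +_)
  (trans (sumℚ-map-∘ _ _ (pairs m)) (sum-pairs m (Ψ ∘ suc))))
  (sym (∑-front (λ b → Ψ b (suc m ∸ b)) (suc m)))

sum-vertices : ∀ n (Φ : ℕ → ℕ → ℕ → ℚ) →
  sumℚ (map (byCoords Φ) (vertices n)) ≡ ∑[ a < suc n ] ∑[ b < suc (n ∸ a) ] Φ a b (n ∸ a ∸ b)
sum-vertices zero    Φ = trans (ℚ.+-identityʳ (Φ 0 0 0)) (sym (trans (ℚ.+-identityˡ _) (ℚ.+-identityˡ (Φ 0 0 0))))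
sum-vertices (suc n) Φ = begin
  sumℚ (map (byCoords Φ) (map _ (pairs (suc n)) ++ map _ (vertices n)))
    ≡⟨ cong sumℚ (List.map-++ (byCoords Φ) (map _ (pairs (suc n))) (map _ (vertices n))) ⟩
  sumℚ (map (byCoords Φ) (map _ (pairs (suc n))) ++ map (byCoords Φ) (map _ (vertices n)))
    ≡⟨ sumℚ-++ (map (byCoords Φ) (map _ (pairs (suc n)))) (map (byCoords Φ) (map _ (vertices n))) ⟩
  sumℚ (map (byCoords Φ) (map _ (pairs (suc n)))) + sumℚ (map (byCoords Φ) (map _ (vertices n)))
    ≡⟨ cong₂ _+_ (trans (sumℚ-map-∘ (byCoords Φ) _ (pairs (suc n))) (sum-pairs (suc n) (Φ 0)))
                 (trans (sumℚ-map-∘ (byCoords Φ) _ (vertices n)) (sum-vertices n (Φ ∘ suc))) ⟩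
  row 0 + ∑[ a < suc n ] row (suc a)
    ≡⟨ sym (∑-front row (suc n)) ⟩
  ∑ (suc (suc n)) row ∎
  where
  open ≡-Reasoning
  row : ℕ → ℚ
  row a = ∑[ b < suc (suc n ∸ a) ] Φ a b (suc n ∸ a ∸ b)

ind-if : ∀ b z → (if b then z else 0ℚ) ≡ ind b * z
ind-if true  z = sym (ℚ.*-identityˡ z)
ind-if false z = sym (ℚ.*-zeroˡ z)

ind-∧ : ∀ b c → ind (b ∧ c) ≡ ind b * ind c
ind-∧ true  c = sym (ℚ.*-identityˡ (ind c))
ind-∧ false c = sym (ℚ.*-zeroˡ (ind c))

ind-≡ᵇ-≡ : ∀ {a b} → a ≡ b → ind (a ≡ᵇ b) ≡ 1ℚ
ind-≡ᵇ-≡ {a} {b} a≡b with a ≡ᵇ b | ℕ.≡⇒≡ᵇ a b a≡b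
... | true | _ = refl

ind-≡ᵇ-≢ : ∀ {a b} → a ≢ b → ind (a ≡ᵇ b) ≡ 0ℚ
ind-≡ᵇ-≢ {a} {b} a≢b with a ≡ᵇ b in eq
... | true  = ⊥-elim (a≢b (ℕ.≡ᵇ⇒≡ a b (subst T (sym eq) _)))
... | false = refl

∑-δ : ∀ (φ : ℕ → ℚ) L {u₀} → u₀ < L → ∑[ u < L ] (ind (u ≡ᵇ u₀) * φ u) ≡ φ u₀
∑-δ φ L {u₀} u₀<L = begin
  ∑[ u < L ] (ind (u ≡ᵇ u₀) * φ u) ≡⟨ ∑-single _ L u₀<L (λ u _ u≢u₀ → trans (cong (_* φ u) (ind-≡ᵇ-≢ u≢u₀)) (ℚ.*-zeroˡ (φ u))) ⟩
  ind (u₀ ≡ᵇ u₀) * φ u₀            ≡⟨ cong (_* φ u₀) (ind-≡ᵇ-≡ {u₀} refl) ⟩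
  1ℚ * φ u₀                        ≡⟨ ℚ.*-identityˡ (φ u₀) ⟩
  φ u₀                             ∎
  where open ≡-Reasoning

∑-δ-outside : ∀ (φ : ℕ → ℚ) L {u₀} → L ≤ u₀ → ∑[ u < L ] (ind (u ≡ᵇ u₀) * φ u) ≡ 0ℚ
∑-δ-outside φ L L≤u₀ = ∑-zero _ L (λ u u<L →
  trans (cong (_* φ u) (ind-≡ᵇ-≢ (ℕ.<⇒≢ (ℕ.<-≤-trans u<L L≤u₀)))) (ℚ.*-zeroˡ (φ u)))

∸-swap-≤ : ∀ {a q n} → q ≤ n → a ≤ n ∸ q → q ≤ n ∸ a
∸-swap-≤ {a} {q} {n} q≤n a≤n∸q = ℕ.m+n≤o⇒m≤o∸n q (subst (_≤ n) (ℕ.+-comm a q) (ℕ.m≤o∸n⇒m+n≤o a q≤n a≤n∸q))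

∑-triangle-δ : ∀ {n q} (φ : ℕ → ℕ → ℚ) → q ≤ n →
  ∑[ a < suc n ] ∑[ b < suc (n ∸ a) ] (ind (b ≡ᵇ q) * φ a b) ≡ ∑[ a < suc (n ∸ q) ] φ a q
∑-triangle-δ {n} {q} φ q≤n = begin
  ∑[ a < suc n ] column a            ≡⟨ ∑-truncate column (s≤s (ℕ.m∸n≤m n q)) outside ⟩
  ∑[ a < suc (n ∸ q) ] column a      ≡⟨ ∑-cong (suc (n ∸ q)) (λ a a< → ∑-δ (φ a) _ (s≤s (∸-swap-≤ q≤n (ℕ.≤-pred a<)))) ⟩
  ∑[ a < suc (n ∸ q) ] φ a q         ∎
  where
  open ≡-Reasoning
  column : ℕ → ℚ
  column a = ∑[ b < suc (n ∸ a) ] (ind (b ≡ᵇ q) * φ a b)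
  outside : ∀ a → suc (n ∸ q) ≤ a → a < suc n → column a ≡ 0ℚ
  outside a n∸q<a a<1+n = ∑-δ-outside (φ a) _ (ℕ.≰⇒> (λ q≤n∸a →
    ℕ.<⇒≱ n∸q<a (∸-swap-≤ (ℕ.≤-pred a<1+n) q≤n∸a)))

third-coordinate : ∀ {a b c a′ b′ c′} → a ℕ.+ b ℕ.+ c ≡ a′ ℕ.+ b′ ℕ.+ c′ → a ≡ a′ → b ≡ b′ → c ≡ c′
third-coordinate {a} {b} eq refl refl = ℕ.+-cancelˡ-≡ (a ℕ.+ b) _ _ eq

ind-adjacent : ∀ e₁ e₂ e₃ → (T e₁ → T e₂ → T e₃) → (T e₁ → T e₃ → T e₂) → (T e₂ → T e₃ → T e₁) →
  ind (((if e₁ then 0 else 1) ℕ.+ (if e₂ then 0 else 1) ℕ.+ (if e₃ then 0 else 1)) ≡ᵇ 2)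
    ≡ ind e₁ + ind e₂ + ind e₃ - ℕ→ℚ 3 * ind (e₁ ∧ e₂)
ind-adjacent true  true  true  _ _ _ = refl
ind-adjacent true  true  false h _ _ = ⊥-elim (h _ _)
ind-adjacent true  false true  _ h _ = ⊥-elim (h _ _)
ind-adjacent false true  true  _ _ h = ⊥-elim (h _ _)
ind-adjacent true  false false _ _ _ = refl
ind-adjacent false true  false _ _ _ = refl
ind-adjacent false false true  _ _ _ = refl
ind-adjacent false false false _ _ _ = refl

private
  +-comm₂₃ : ∀ a b c → a ℕ.+ b ℕ.+ c ≡ a ℕ.+ c ℕ.+ b
  +-comm₂₃ = solve-∀

  +-rotate : ∀ a b c → a ℕ.+ b ℕ.+ c ≡ b ℕ.+ c ℕ.+ a
  +-rotate = solve-∀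

-- On the plane i + j + k = n two agreeing coordinates force the third to agree, so y ∼ x exactly
-- when one coordinate agrees, and the correction term removes x = y.
ind-adjacentᵇ : ∀ {n} (x y : Vertex n) → ind (adjacentᵇ x y) ≡
  ind (i x ≡ᵇ i y) + ind (j x ≡ᵇ j y) + ind (k x ≡ᵇ k y) - ℕ→ℚ 3 * ind ((i x ≡ᵇ i y) ∧ (j x ≡ᵇ j y))
ind-adjacentᵇ (vtx a b c refl) (vtx a′ b′ c′ eq) = ind-adjacent (a ≡ᵇ a′) (b ≡ᵇ b′) (c ≡ᵇ c′)
  (λ a≡ b≡ → ℕ.≡⇒≡ᵇ c c′ (third-coordinate (sym eq) (ℕ.≡ᵇ⇒≡ a a′ a≡) (ℕ.≡ᵇ⇒≡ b b′ b≡)))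
  (λ a≡ c≡ → ℕ.≡⇒≡ᵇ b b′ (third-coordinate (trans (sym (+-comm₂₃ a b c)) (trans (sym eq) (+-comm₂₃ a′ b′ c′)))
                                             (ℕ.≡ᵇ⇒≡ a a′ a≡) (ℕ.≡ᵇ⇒≡ c c′ c≡)))
  (λ b≡ c≡ → ℕ.≡⇒≡ᵇ a a′ (third-coordinate (trans (sym (+-rotate a b c)) (trans (sym eq) (+-rotate a′ b′ c′)))
                                             (ℕ.≡ᵇ⇒≡ b b′ b≡) (ℕ.≡ᵇ⇒≡ c c′ c≡)))

module _ {n : ℕ} where

  open ≡-Reasoning

  sum-vertices-i : ∀ (h : ℕ → ℕ → ℕ → ℚ) {p} → p ≤ n →
    sumℚ (map (λ x → ind (i x ≡ᵇ p) * byCoords h x) (vertices n)) ≡ ∑[ b < suc (n ∸ p) ] h p b (n ∸ p ∸ b)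
  sum-vertices-i h {p} p≤n = begin
    sumℚ (map (λ x → ind (i x ≡ᵇ p) * byCoords h x) (vertices n))
      ≡⟨ sum-vertices n (λ a b c → ind (a ≡ᵇ p) * h a b c) ⟩
    ∑[ a < suc n ] ∑[ b < suc (n ∸ a) ] (ind (a ≡ᵇ p) * h a b (n ∸ a ∸ b))
      ≡⟨ ∑-cong (suc n) (λ a _ → ∑-*ˡ (ind (a ≡ᵇ p)) (λ b → h a b (n ∸ a ∸ b)) (suc (n ∸ a))) ⟩
    ∑[ a < suc n ] (ind (a ≡ᵇ p) * ∑[ b < suc (n ∸ a) ] h a b (n ∸ a ∸ b))
      ≡⟨ ∑-δ (λ a → ∑[ b < suc (n ∸ a) ] h a b (n ∸ a ∸ b)) (suc n) (s≤s p≤n) ⟩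
    ∑[ b < suc (n ∸ p) ] h p b (n ∸ p ∸ b) ∎

  sum-vertices-j : ∀ (h : ℕ → ℕ → ℕ → ℚ) {q} → q ≤ n →
    sumℚ (map (λ x → ind (j x ≡ᵇ q) * byCoords h x) (vertices n)) ≡ ∑[ a < suc (n ∸ q) ] h a q (n ∸ a ∸ q)
  sum-vertices-j h q≤n = trans (sum-vertices n (λ a b c → ind (b ≡ᵇ _) * h a b c))
    (∑-triangle-δ (λ a b → h a b (n ∸ a ∸ b)) q≤n)

  sum-vertices-k : ∀ (h : ℕ → ℕ → ℕ → ℚ) {r} → r ≤ n →
    sumℚ (map (λ x → ind (k x ≡ᵇ r) * byCoords h x) (vertices n)) ≡ ∑[ a < suc (n ∸ r) ] h a (n ∸ a ∸ r) r
  sum-vertices-k h {r} r≤n = begin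
    sumℚ (map (λ x → ind (k x ≡ᵇ r) * byCoords h x) (vertices n))
      ≡⟨ sum-vertices n (λ a b c → ind (c ≡ᵇ r) * h a b c) ⟩
    ∑[ a < suc n ] ∑[ b < suc (n ∸ a) ] (ind (n ∸ a ∸ b ≡ᵇ r) * h a b (n ∸ a ∸ b))
      ≡⟨ ∑-cong (suc n) (λ a _ → reversed a) ⟩
    ∑[ a < suc n ] ∑[ b < suc (n ∸ a) ] (ind (b ≡ᵇ r) * h a (n ∸ a ∸ b) b)
      ≡⟨ ∑-triangle-δ (λ a b → h a (n ∸ a ∸ b) b) r≤n ⟩
    ∑[ a < suc (n ∸ r) ] h a (n ∸ a ∸ r) r ∎
    where
    reversed : ∀ a → ∑[ b < suc (n ∸ a) ] (ind (n ∸ a ∸ b ≡ᵇ r) * h a b (n ∸ a ∸ b))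
                   ≡ ∑[ b < suc (n ∸ a) ] (ind (b ≡ᵇ r) * h a (n ∸ a ∸ b) b)
    reversed a = trans (∑-reverse _ (n ∸ a)) (∑-cong (suc (n ∸ a)) (λ b b< →
      cong (λ c → ind (c ≡ᵇ r) * h a (n ∸ a ∸ b) c) (ℕ.m∸[m∸n]≡n (ℕ.≤-pred b<))))

  sum-vertices-ij : ∀ (h : ℕ → ℕ → ℕ → ℚ) {p q} → p ≤ n → q ≤ n ∸ p →
    sumℚ (map (λ x → ind ((i x ≡ᵇ p) ∧ (j x ≡ᵇ q)) * byCoords h x) (vertices n)) ≡ h p q (n ∸ p ∸ q)
  sum-vertices-ij h {p} {q} p≤n q≤n∸p = begin
    sumℚ (map (λ x → ind ((i x ≡ᵇ p) ∧ (j x ≡ᵇ q)) * byCoords h x) (vertices n))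
      ≡⟨ sumℚ-map-cong (λ x → trans (cong (_* byCoords h x) (ind-∧ (i x ≡ᵇ p) (j x ≡ᵇ q)))
                                    (ℚ.*-assoc (ind (i x ≡ᵇ p)) (ind (j x ≡ᵇ q)) (byCoords h x))) (vertices n) ⟩
    sumℚ (map (λ x → ind (i x ≡ᵇ p) * (ind (j x ≡ᵇ q) * byCoords h x)) (vertices n))
      ≡⟨ sum-vertices-i (λ a b c → ind (b ≡ᵇ q) * h a b c) p≤n ⟩
    ∑[ b < suc (n ∸ p) ] (ind (b ≡ᵇ q) * h p b (n ∸ p ∸ b))
      ≡⟨ ∑-δ (λ b → h p b (n ∸ p ∸ b)) (suc (n ∸ p)) (s≤s q≤n∸p) ⟩
    h p q (n ∸ p ∸ q) ∎

i≤n : ∀ {n} (x : Vertex n) → i x ≤ n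
i≤n (vtx p q r refl) = ℕ.≤-trans (ℕ.m≤m+n p q) (ℕ.m≤m+n (p ℕ.+ q) r)

j≤n : ∀ {n} (x : Vertex n) → j x ≤ n
j≤n (vtx p q r refl) = ℕ.≤-trans (ℕ.m≤n+m q p) (ℕ.m≤m+n (p ℕ.+ q) r)

k≤n : ∀ {n} (x : Vertex n) → k x ≤ n
k≤n (vtx p q r refl) = ℕ.m≤n+m r (p ℕ.+ q)

A-byCoords : ∀ {n} (h : ℕ → ℕ → ℕ → ℚ) (y : Vertex n) →
  A (byCoords h) y ≡
      ∑[ b < suc (n ∸ i y) ] h (i y) b (n ∸ i y ∸ b)
    + ∑[ a < suc (n ∸ j y) ] h a (j y) (n ∸ a ∸ j y)
    + ∑[ a < suc (n ∸ k y) ] h a (n ∸ a ∸ k y) (k y)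
    - ℕ→ℚ 3 * h (i y) (j y) (k y)
A-byCoords {n} h y@(vtx p q r refl) = begin
  A v y
    ≡⟨ sumℚ-map-cong (λ x → trans (ind-if (adjacentᵇ x y) (v x)) (cong (_* v x) (ind-adjacentᵇ x y))) (vertices n) ⟩
  sumℚ (map (λ x → (I₁ x + I₂ x + I₃ x - ℕ→ℚ 3 * I₁₂ x) * v x) (vertices n))
    ≡⟨ sumℚ-map-cong (λ x → solve 6 (λ a b c d t w → (a :+ b :+ c :- t :* d) :* w := a :* w :+ b :* w :+ c :* w :+ (:- t) :* (d :* w))
                              refl (I₁ x) (I₂ x) (I₃ x) (I₁₂ x) (ℕ→ℚ 3) (v x)) (vertices n) ⟩
  sumℚ (map (λ x → I₁ x * v x + I₂ x * v x + I₃ x * v x + (- ℕ→ℚ 3) * (I₁₂ x * v x)) (vertices n))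
    ≡⟨ trans (sumℚ-map-+ _ _ (vertices n)) (cong₂ _+_
         (trans (sumℚ-map-+ _ _ (vertices n)) (cong (_+ S I₃) (sumℚ-map-+ _ _ (vertices n))))
         (sumℚ-map-*ˡ (- ℕ→ℚ 3) _ (vertices n))) ⟩
  S I₁ + S I₂ + S I₃ + (- ℕ→ℚ 3) * S I₁₂
    ≡⟨ cong₂ _+_ (cong₂ _+_ (cong₂ _+_ (sum-vertices-i h (i≤n y)) (sum-vertices-j h (j≤n y))) (sum-vertices-k h (k≤n y)))
                 (cong (- ℕ→ℚ 3 *_) (trans (sum-vertices-ij h (i≤n y) q≤n∸p) (cong (h p q) n∸p∸q≡r))) ⟩
  Row + ColJ + ColK + (- ℕ→ℚ 3) * h p q r
    ≡⟨ solve 5 (λ a b c t z → a :+ b :+ c :+ (:- t) :* z := a :+ b :+ c :- t :* z) refl Row ColJ ColK (ℕ→ℚ 3) (h p q r) ⟩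
  Row + ColJ + ColK - ℕ→ℚ 3 * h p q r ∎
  where
  open ≡-Reasoning
  v : Vect n
  v = byCoords h
  I₁ I₂ I₃ I₁₂ : Vertex n → ℚ
  I₁ x = ind (i x ≡ᵇ p)
  I₂ x = ind (j x ≡ᵇ q)
  I₃ x = ind (k x ≡ᵇ r)
  I₁₂ x = ind ((i x ≡ᵇ p) ∧ (j x ≡ᵇ q))
  S : (Vertex n → ℚ) → ℚ
  S I = sumℚ (map (λ x → I x * v x) (vertices n))
  Row ColJ ColK : ℚ
  Row = ∑[ b < suc (n ∸ p) ] h p b (n ∸ p ∸ b)
  ColJ = ∑[ a < suc (n ∸ q) ] h a q (n ∸ a ∸ q)
  ColK = ∑[ a < suc (n ∸ r) ] h a (n ∸ a ∸ r) r
  n∸p≡q+r : n ∸ p ≡ q ℕ.+ r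
  n∸p≡q+r = trans (cong (_∸ p) (ℕ.+-assoc p q r)) (ℕ.m+n∸m≡n p (q ℕ.+ r))
  q≤n∸p : q ≤ n ∸ p
  q≤n∸p = subst (q ≤_) (sym n∸p≡q+r) (ℕ.m≤m+n q r)
  n∸p∸q≡r : n ∸ p ∸ q ≡ r
  n∸p∸q≡r = trans (cong (_∸ q) n∸p≡q+r) (ℕ.m+n∸m≡n q r)

A-cong : ∀ {n} {u v : Vect n} → u ≈ v → A u ≈ A v
A-cong {n} u≈v y = sumℚ-map-cong (λ x → cong (λ z → if adjacentᵇ x y then z else 0ℚ) (u≈v x)) (vertices n)

partialSum : (ℕ → ℚ) → ℕ → ℚ
partialSum f m = ∑[ t < suc m ] f t

separable : ∀ {n} → (ℕ → ℚ) → (ℕ → ℚ) → Vect n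
separable f g = byCoords (λ a b c → f a + f b + g c)

separable-s₁₂ : ∀ {n} (f g : ℕ → ℚ) x → separable {n} f g (act s₁₂ x) ≡ separable f g x
separable-s₁₂ f g (vtx a b c _) = cong (_+ g c) (ℚ.+-comm (f b) (f a))

∸-∸-comm : ∀ n a b → n ∸ a ∸ b ≡ n ∸ b ∸ a
∸-∸-comm n a b = trans (ℕ.∸-+-assoc n a b) (trans (cong (n ∸_) (ℕ.+-comm a b)) (sym (ℕ.∸-+-assoc n b a)))

line-sum : ∀ m (α β : ℕ → ℚ) c →
  ∑[ b < suc m ] (α b + β (m ∸ b) + c) ≡ partialSum α m + partialSum β m + (1ℚ + ℕ→ℚ m) * c
line-sum m α β c = begin
  ∑[ b < suc m ] (α b + β (m ∸ b) + c)
    ≡⟨ ∑-+ (λ b → α b + β (m ∸ b)) (λ _ → c) (suc m) ⟩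
  ∑[ b < suc m ] (α b + β (m ∸ b)) + ∑[ _ < suc m ] c
    ≡⟨ cong₂ _+_ (∑-+ α (λ b → β (m ∸ b)) (suc m)) (∑-const c (suc m)) ⟩
  partialSum α m + ∑[ b < suc m ] β (m ∸ b) + ℕ→ℚ (suc m) * c
    ≡⟨ cong₂ (λ s t → partialSum α m + s + t * c) (sym (∑-reverse β m)) (ℕ→ℚ-suc m) ⟩
  partialSum α m + partialSum β m + (1ℚ + ℕ→ℚ m) * c ∎
  where open ≡-Reasoning

module _ {n : ℕ} (f g : ℕ → ℚ) where

  open ≡-Reasoning

  separable-row : ∀ p → ∑[ b < suc (n ∸ p) ] (f p + f b + g (n ∸ p ∸ b))
                      ≡ partialSum f (n ∸ p) + partialSum g (n ∸ p) + (1ℚ + ℕ→ℚ (n ∸ p)) * f p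
  separable-row p = trans
    (∑-cong (suc (n ∸ p)) (λ b _ → solve 3 (λ x y z → x :+ y :+ z := y :+ z :+ x) refl (f p) (f b) (g (n ∸ p ∸ b))))
    (line-sum (n ∸ p) f g (f p))

  separable-column-j : ∀ q → ∑[ a < suc (n ∸ q) ] (f a + f q + g (n ∸ a ∸ q))
                           ≡ partialSum f (n ∸ q) + partialSum g (n ∸ q) + (1ℚ + ℕ→ℚ (n ∸ q)) * f q
  separable-column-j q = trans
    (∑-cong (suc (n ∸ q)) (λ a _ → trans (cong (λ c → f a + f q + g c) (∸-∸-comm n a q))
      (solve 3 (λ x y z → x :+ y :+ z := x :+ z :+ y) refl (f a) (f q) (g (n ∸ q ∸ a)))))
    (line-sum (n ∸ q) f g (f q))

  separable-column-k : ∀ r → ∑[ a < suc (n ∸ r) ] (f a + f (n ∸ a ∸ r) + g r)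
                           ≡ partialSum f (n ∸ r) + partialSum f (n ∸ r) + (1ℚ + ℕ→ℚ (n ∸ r)) * g r
  separable-column-k r = trans
    (∑-cong (suc (n ∸ r)) (λ a _ → cong (λ c → f a + f c + g r) (∸-∸-comm n a r)))
    (line-sum (n ∸ r) f f (g r))

  separable-eigenvector : (μ : ℚ) →
    (∀ t → t ≤ n → partialSum f (n ∸ t) + partialSum g (n ∸ t) + (ℕ→ℚ (n ∸ t) - μ) * f t ≡ 0ℚ) →
    (∀ t → t ≤ n → partialSum f (n ∸ t) + partialSum f (n ∸ t) + (ℕ→ℚ (n ∸ t) - μ) * g t ≡ 0ℚ) →
    A (separable f g) ≈ ((μ - ℕ→ℚ 2) ·V separable f g)
  separable-eigenvector μ row-identity column-identity y = begin
    A (separable f g) y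
      ≡⟨ A-byCoords (λ a b c → f a + f b + g c) y ⟩
    Row + ColJ + ColK - ℕ→ℚ 3 * (f p + f q + g r)
      ≡⟨ cong₂ (λ s t → s + t - ℕ→ℚ 3 * (f p + f q + g r))
           (cong₂ _+_ (trans (separable-row p) (row-value p (i≤n y)))
                      (trans (separable-column-j q) (row-value q (j≤n y))))
           (trans (separable-column-k r) (column-value r (k≤n y))) ⟩
    (1ℚ + μ) * f p + (1ℚ + μ) * f q + (1ℚ + μ) * g r - ℕ→ℚ 3 * (f p + f q + g r)
      ≡⟨ solve 4 (λ m x y z → (con 1ℚ :+ m) :* x :+ (con 1ℚ :+ m) :* y :+ (con 1ℚ :+ m) :* z :- con (ℕ→ℚ 3) :* (x :+ y :+ z)
                              := (m :- con (ℕ→ℚ 2)) :* (x :+ y :+ z)) refl μ (f p) (f q) (g r) ⟩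
    (μ - ℕ→ℚ 2) * (f p + f q + g r) ∎
    where
    p q r : ℕ
    p = i y
    q = j y
    r = k y
    Row ColJ ColK : ℚ
    Row = ∑[ b < suc (n ∸ p) ] (f p + f b + g (n ∸ p ∸ b))
    ColJ = ∑[ a < suc (n ∸ q) ] (f a + f q + g (n ∸ a ∸ q))
    ColK = ∑[ a < suc (n ∸ r) ] (f a + f (n ∸ a ∸ r) + g r)
    line-value : ∀ F G m x → F + G + (m - μ) * x ≡ 0ℚ → F + G + (1ℚ + m) * x ≡ (1ℚ + μ) * x
    line-value F G m x vanishes = begin
      F + G + (1ℚ + m) * x                       ≡⟨ solve 5 (λ F G m μ x → F :+ G :+ (con 1ℚ :+ m) :* x
                                                       := (F :+ G :+ (m :- μ) :* x) :+ (con 1ℚ :+ μ) :* x) refl F G m μ x ⟩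
      (F + G + (m - μ) * x) + (1ℚ + μ) * x       ≡⟨ cong (_+ (1ℚ + μ) * x) vanishes ⟩
      0ℚ + (1ℚ + μ) * x                          ≡⟨ ℚ.+-identityˡ _ ⟩
      (1ℚ + μ) * x                               ∎
    row-value : ∀ t → t ≤ n →
      partialSum f (n ∸ t) + partialSum g (n ∸ t) + (1ℚ + ℕ→ℚ (n ∸ t)) * f t ≡ (1ℚ + μ) * f t
    row-value t t≤n = line-value (partialSum f (n ∸ t)) (partialSum g (n ∸ t)) (ℕ→ℚ (n ∸ t)) (f t) (row-identity t t≤n)
    column-value : ∀ t → t ≤ n →
      partialSum f (n ∸ t) + partialSum f (n ∸ t) + (1ℚ + ℕ→ℚ (n ∸ t)) * g t ≡ (1ℚ + μ) * g t
    column-value t t≤n = line-value (partialSum f (n ∸ t)) (partialSum f (n ∸ t)) (ℕ→ℚ (n ∸ t)) (g t) (column-identity t t≤n)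

+-zeros : ∀ {a b} → a ≡ 0ℚ → b ≡ 0ℚ → a + b ≡ 0ℚ
+-zeros refl refl = refl

*-eliminateʳ : ∀ {c d} → d ≢ 0ℚ → c * d ≡ 0ℚ → c ≡ 0ℚ
*-eliminateʳ {c} {d} d≢0 cd≡0 = begin
  c                  ≡⟨ sym (ℚ.*-identityʳ c) ⟩
  c * 1ℚ             ≡⟨ cong (c *_) (sym (ℚ.*-inverseʳ d)) ⟩
  c * (d * 1/ d)     ≡⟨ sym (ℚ.*-assoc c d (1/ d)) ⟩
  c * d * 1/ d       ≡⟨ cong (_* 1/ d) cd≡0 ⟩
  0ℚ * 1/ d          ≡⟨ ℚ.*-zeroˡ (1/ d) ⟩
  0ℚ                 ∎
  where
  open ≡-Reasoning
  instance _ = ≢-nonZero d≢0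

vertex-≡ : ∀ {n} {x y : Vertex n} → i x ≡ i y → j x ≡ j y → k x ≡ k y → x ≡ y
vertex-≡ {x = vtx a b c p} {vtx a b c q} refl refl refl = cong (vtx a b c) (ℕ.≡-irrelevant p q)

δ₃ : Fin 3 → Fin 3 → ℚ
δ₃ r s = ind (toℕ r ≡ᵇ toℕ s)

lincomb-δ₃ : ∀ {n} (B : Fin 3 → Vect n) r x → lincomb (δ₃ r) B x ≡ B r x
lincomb-δ₃ B zero             x = solve 3 (λ a b c → con 1ℚ :* a :+ (con 0ℚ :* b :+ (con 0ℚ :* c :+ con 0ℚ)) := a)
  refl (B zero x) (B (suc zero) x) (B (suc (suc zero)) x)
lincomb-δ₃ B (suc zero)       x = solve 3 (λ a b c → con 0ℚ :* a :+ (con 1ℚ :* b :+ (con 0ℚ :* c :+ con 0ℚ)) := b)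
  refl (B zero x) (B (suc zero) x) (B (suc (suc zero)) x)
lincomb-δ₃ B (suc (suc zero)) x = solve 3 (λ a b c → con 0ℚ :* a :+ (con 0ℚ :* b :+ (con 1ℚ :* c :+ con 0ℚ)) := c)
  refl (B zero x) (B (suc zero) x) (B (suc (suc zero)) x)

lincomb-diagonal₃ : ∀ {n} (c : Fin 3 → ℚ) (B : Fin 3 → Vect n) (x : Fin 3 → Vertex n) {d} →
  (∀ r → B r (x r) ≡ d) → (∀ r s → r ≢ s → B s (x r) ≡ 0ℚ) → ∀ r → lincomb c B (x r) ≡ c r * d
lincomb-diagonal₃ c B x {d} diag off r = begin
  c zero * B zero (x r) + (c (suc zero) * B (suc zero) (x r) + (c (suc (suc zero)) * B (suc (suc zero)) (x r) + 0ℚ))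
    ≡⟨ cong₂ (λ u w → c zero * u + w) (entry zero) (cong₂ (λ u w → c (suc zero) * u + w) (entry (suc zero))
         (cong (λ u → c (suc (suc zero)) * u + 0ℚ) (entry (suc (suc zero))))) ⟩
  c zero * (δ₃ zero r * d) + (c (suc zero) * (δ₃ (suc zero) r * d) + (c (suc (suc zero)) * (δ₃ (suc (suc zero)) r * d) + 0ℚ))
    ≡⟨ collapse r ⟩
  c r * d ∎
  where
  open ≡-Reasoning
  entry : ∀ s → B s (x r) ≡ δ₃ s r * d
  entry s with toℕ s ≡ᵇ toℕ r in eq
  ... | true  = trans (cong (λ t → B t (x r)) (Fin.toℕ-injective (ℕ.≡ᵇ⇒≡ _ _ (subst T (sym eq) _))))
                      (trans (diag r) (sym (ℚ.*-identityˡ d)))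
  ... | false = trans (off r s (λ r≡s → subst T eq (ℕ.≡⇒≡ᵇ _ _ (cong toℕ (sym r≡s))))) (sym (ℚ.*-zeroˡ d))
  collapse : ∀ r → c zero * (δ₃ zero r * d) + (c (suc zero) * (δ₃ (suc zero) r * d) + (c (suc (suc zero)) * (δ₃ (suc (suc zero)) r * d) + 0ℚ)) ≡ c r * d
  collapse zero             = solve 4 (λ a b e d → a :* (con 1ℚ :* d) :+ (b :* (con 0ℚ :* d) :+ (e :* (con 0ℚ :* d) :+ con 0ℚ)) := a :* d)
                                refl (c zero) (c (suc zero)) (c (suc (suc zero))) d
  collapse (suc zero)       = solve 4 (λ a b e d → a :* (con 0ℚ :* d) :+ (b :* (con 1ℚ :* d) :+ (e :* (con 0ℚ :* d) :+ con 0ℚ)) := b :* d)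
                                refl (c zero) (c (suc zero)) (c (suc (suc zero))) d
  collapse (suc (suc zero)) = solve 4 (λ a b e d → a :* (con 0ℚ :* d) :+ (b :* (con 0ℚ :* d) :+ (e :* (con 1ℚ :* d) :+ con 0ℚ)) := e :* d)
                                refl (c zero) (c (suc zero)) (c (suc (suc zero))) d

δS₃ : S₃ → S₃ → ℚ
δS₃ e    e    = 1ℚ
δS₃ s₁₂  s₁₂  = 1ℚ
δS₃ s₁₃  s₁₃  = 1ℚ
δS₃ s₂₃  s₂₃  = 1ℚ
δS₃ c₁₂₃ c₁₂₃ = 1ℚ
δS₃ c₁₃₂ c₁₃₂ = 1ℚ
δS₃ _    _    = 0ℚ

InSpanS₃-member : ∀ {n} (F : S₃ → Vect n) σ → InSpanS₃ (F σ) F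
InSpanS₃-member F σ = δS₃ σ , λ x → sym (pick σ x)
  where
  pick : ∀ σ x → sumV (map (λ τ → δS₃ σ τ ·V F τ) (e ∷ s₁₂ ∷ s₁₃ ∷ s₂₃ ∷ c₁₂₃ ∷ c₁₃₂ ∷ [])) x ≡ F σ x
  pick e    x = solve 6 (λ a b c d f g → con 1ℚ :* a :+ (con 0ℚ :* b :+ (con 0ℚ :* c :+ (con 0ℚ :* d :+ (con 0ℚ :* f :+ (con 0ℚ :* g :+ con 0ℚ))))) := a)
    refl (F e x) (F s₁₂ x) (F s₁₃ x) (F s₂₃ x) (F c₁₂₃ x) (F c₁₃₂ x)
  pick s₁₂  x = solve 6 (λ a b c d f g → con 0ℚ :* a :+ (con 1ℚ :* b :+ (con 0ℚ :* c :+ (con 0ℚ :* d :+ (con 0ℚ :* f :+ (con 0ℚ :* g :+ con 0ℚ))))) := b)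
    refl (F e x) (F s₁₂ x) (F s₁₃ x) (F s₂₃ x) (F c₁₂₃ x) (F c₁₃₂ x)
  pick s₁₃  x = solve 6 (λ a b c d f g → con 0ℚ :* a :+ (con 0ℚ :* b :+ (con 1ℚ :* c :+ (con 0ℚ :* d :+ (con 0ℚ :* f :+ (con 0ℚ :* g :+ con 0ℚ))))) := c)
    refl (F e x) (F s₁₂ x) (F s₁₃ x) (F s₂₃ x) (F c₁₂₃ x) (F c₁₃₂ x)
  pick s₂₃  x = solve 6 (λ a b c d f g → con 0ℚ :* a :+ (con 0ℚ :* b :+ (con 0ℚ :* c :+ (con 1ℚ :* d :+ (con 0ℚ :* f :+ (con 0ℚ :* g :+ con 0ℚ))))) := d)
    refl (F e x) (F s₁₂ x) (F s₁₃ x) (F s₂₃ x) (F c₁₂₃ x) (F c₁₃₂ x)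
  pick c₁₂₃ x = solve 6 (λ a b c d f g → con 0ℚ :* a :+ (con 0ℚ :* b :+ (con 0ℚ :* c :+ (con 0ℚ :* d :+ (con 1ℚ :* f :+ (con 0ℚ :* g :+ con 0ℚ))))) := f)
    refl (F e x) (F s₁₂ x) (F s₁₃ x) (F s₂₃ x) (F c₁₂₃ x) (F c₁₃₂ x)
  pick c₁₃₂ x = solve 6 (λ a b c d f g → con 0ℚ :* a :+ (con 0ℚ :* b :+ (con 0ℚ :* c :+ (con 0ℚ :* d :+ (con 0ℚ :* f :+ (con 1ℚ :* g :+ con 0ℚ))))) := g)
    refl (F e x) (F s₁₂ x) (F s₁₃ x) (F s₂₃ x) (F c₁₂₃ x) (F c₁₃₂ x)

module _ {n : ℕ} (v : Vect n) (s₁₂-invariant : ∀ x → v (act s₁₂ x) ≡ v x) where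

  private
    v-cong-s₁₂ : ∀ {x y} → act s₁₂ x ≡ y → v x ≡ v y
    v-cong-s₁₂ {x} refl = sym (s₁₂-invariant x)

  orbit-generator : Fin 3 → S₃
  orbit-generator zero             = e
  orbit-generator (suc zero)       = s₁₃
  orbit-generator (suc (suc zero)) = s₂₃

  orbit-basis : Fin 3 → Vect n
  orbit-basis r = actV (orbit-generator r) v

  orbit-index : S₃ → Fin 3
  orbit-index e    = zero
  orbit-index s₁₂  = zero
  orbit-index s₁₃  = suc zero
  orbit-index c₁₂₃ = suc zero
  orbit-index s₂₃  = suc (suc zero)
  orbit-index c₁₃₂ = suc (suc zero)

  orbit≈basis : ∀ τ → actV τ v ≈ orbit-basis (orbit-index τ)
  orbit≈basis e    x           = refl
  orbit≈basis s₁₂  x           = s₁₂-invariant x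
  orbit≈basis s₁₃  x           = refl
  orbit≈basis s₂₃  x           = refl
  orbit≈basis c₁₂₃ (vtx _ _ _ _) = v-cong-s₁₂ (vertex-≡ refl refl refl)
  orbit≈basis c₁₃₂ (vtx _ _ _ _) = v-cong-s₁₂ (vertex-≡ refl refl refl)

  orbit-span-dimension-3 : (x₀ : Vertex n) → v x₀ ≢ 0ℚ → v (act s₁₃ x₀) ≡ 0ℚ → v (act s₂₃ x₀) ≡ 0ℚ →
    SpanDimS₃ (λ τ → actV τ v) 3
  orbit-span-dimension-3 x₀@(vtx _ _ _ _) v≢0 v-s₁₃≡0 v-s₂₃≡0 =
    orbit-basis ,
    (λ r → InSpanS₃-member (λ τ → actV τ v) (orbit-generator r)) ,
    (λ coeff lincomb≈0 r → *-eliminateʳ v≢0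
       (trans (sym (lincomb-diagonal₃ coeff orbit-basis point diagonal off-diagonal r)) (lincomb≈0 (point r)))) ,
    (λ τ → δ₃ (orbit-index τ) , λ x → trans (orbit≈basis τ x) (sym (lincomb-δ₃ orbit-basis (orbit-index τ) x)))
    where
    point : Fin 3 → Vertex n
    point r = act (orbit-generator r) x₀
    diagonal : ∀ r → orbit-basis r (point r) ≡ v x₀
    diagonal zero             = refl
    diagonal (suc zero)       = cong v (vertex-≡ refl refl refl)
    diagonal (suc (suc zero)) = cong v (vertex-≡ refl refl refl)
    off-diagonal : ∀ r s → r ≢ s → orbit-basis s (point r) ≡ 0ℚ
    off-diagonal zero             zero             r≢s = ⊥-elim (r≢s refl)
    off-diagonal zero             (suc zero)       _   = v-s₁₃≡0
    off-diagonal zero             (suc (suc zero)) _   = v-s₂₃≡0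
    off-diagonal (suc zero)       zero             _   = v-s₁₃≡0
    off-diagonal (suc zero)       (suc zero)       r≢s = ⊥-elim (r≢s refl)
    off-diagonal (suc zero)       (suc (suc zero)) _   = trans (v-cong-s₁₂ (vertex-≡ refl refl refl)) v-s₂₃≡0
    off-diagonal (suc (suc zero)) zero             _   = v-s₂₃≡0
    off-diagonal (suc (suc zero)) (suc zero)       _   = trans (v-cong-s₁₂ (vertex-≡ refl refl refl)) v-s₁₃≡0
    off-diagonal (suc (suc zero)) (suc (suc zero)) r≢s = ⊥-elim (r≢s refl)

restrictTo : List ℕ → (ℕ → ℚ) → ℕ → ℚ
restrictTo R c t = sumℚ (map (λ a → c a * ind (t ≡ᵇ a)) R)

restrictTo-hit : ∀ (c : ℕ → ℚ) s L {u₀} → u₀ < L → restrictTo (map (s ℕ.+_) (upTo L)) c (u₀ ℕ.+ s) ≡ c (s ℕ.+ u₀)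
restrictTo-hit c s L {u₀} u₀<L = begin
  sumℚ (map (λ a → c a * ind (u₀ ℕ.+ s ≡ᵇ a)) (map (s ℕ.+_) (upTo L)))
    ≡⟨ sumℚ-range _ s L ⟩
  ∑[ u < L ] (c (s ℕ.+ u) * ind (u₀ ℕ.+ s ≡ᵇ s ℕ.+ u))
    ≡⟨ ∑-single _ L u₀<L (λ u _ u≢u₀ → trans (cong (c (s ℕ.+ u) *_) (ind-≡ᵇ-≢ (λ eq →
         u≢u₀ (sym (ℕ.+-cancelˡ-≡ s u₀ u (trans (ℕ.+-comm s u₀) eq)))))) (ℚ.*-zeroʳ (c (s ℕ.+ u)))) ⟩
  c (s ℕ.+ u₀) * ind (u₀ ℕ.+ s ≡ᵇ s ℕ.+ u₀)
    ≡⟨ cong (c (s ℕ.+ u₀) *_) (ind-≡ᵇ-≡ (ℕ.+-comm u₀ s)) ⟩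
  c (s ℕ.+ u₀) * 1ℚ
    ≡⟨ ℚ.*-identityʳ (c (s ℕ.+ u₀)) ⟩
  c (s ℕ.+ u₀) ∎
  where open ≡-Reasoning

restrictTo-miss : ∀ (c : ℕ → ℚ) s L {t} → (∀ u → u < L → t ≢ s ℕ.+ u) → restrictTo (map (s ℕ.+_) (upTo L)) c t ≡ 0ℚ
restrictTo-miss c s L miss = trans (sumℚ-range _ s L) (∑-zero _ L (λ u u<L →
  trans (cong (c (s ℕ.+ u) *_) (ind-≡ᵇ-≢ (miss u u<L))) (ℚ.*-zeroʳ (c (s ℕ.+ u)))))

xWeight zWeight : ℕ → ℕ → ℚ
xWeight n a = ℤ→ℚ (ℤ.+ (2 ℕ.* a) ℤ.- ℤ.+ n)
zWeight κ a = ℕ→ℚ (2 ℕ.* (a ∸ κ ∸ 1))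

cornerWeight : ℕ → ℕ → ℚ
cornerWeight n κ = - ℕ→ℚ ((n ∸ 2 ℕ.* κ ∸ 1) ℕ.* (n ∸ 2 ℕ.* κ ∸ 2))

coeffX coeffZ : ℕ → ℕ → ℕ → ℚ
coeffX n κ = restrictTo (range (suc κ) (n ∸ κ ∸ 1)) (xWeight n)
coeffZ n κ t = cornerWeight n κ * ind (t ≡ᵇ n ∸ κ) + restrictTo (range (suc κ) (n ∸ κ ∸ 1)) (zWeight κ) t

P≈separable : ∀ n κ → P n κ ≈ separable (coeffX n κ) (coeffZ n κ)
P≈separable n κ x = begin
  corner + sumV (map _ R) x
    ≡⟨ cong (corner +_) (trans (sumV-apply (map _ R) x) (sumℚ-map-∘ (λ v → v x) _ R)) ⟩
  corner + sumℚ (map (λ a → zWeight κ a * I₃ a + xWeight n a * (I₁ a + I₂ a)) R)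
    ≡⟨ cong (corner +_) (sumℚ-map-cong (λ a → solve 5 (λ z c x u w → z :* c :+ x :* (u :+ w) := x :* u :+ x :* w :+ z :* c)
                                               refl (zWeight κ a) (I₃ a) (xWeight n a) (I₁ a) (I₂ a)) R) ⟩
  corner + sumℚ (map (λ a → xWeight n a * I₁ a + xWeight n a * I₂ a + zWeight κ a * I₃ a) R)
    ≡⟨ cong (corner +_) (trans (sumℚ-map-+ _ _ R) (cong (_+ S (zWeight κ) I₃) (sumℚ-map-+ _ _ R))) ⟩
  corner + (S (xWeight n) I₁ + S (xWeight n) I₂ + S (zWeight κ) I₃)
    ≡⟨ solve 4 (λ c a b z → c :+ (a :+ b :+ z) := a :+ b :+ (c :+ z)) refl corner (S (xWeight n) I₁) (S (xWeight n) I₂) (S (zWeight κ) I₃) ⟩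
  S (xWeight n) I₁ + S (xWeight n) I₂ + (corner + S (zWeight κ) I₃) ∎
  where
  open ≡-Reasoning
  R : List ℕ
  R = range (suc κ) (n ∸ κ ∸ 1)
  I₁ I₂ I₃ : ℕ → ℚ
  I₁ a = ind (i x ≡ᵇ a)
  I₂ a = ind (j x ≡ᵇ a)
  I₃ a = ind (k x ≡ᵇ a)
  S : (ℕ → ℚ) → (ℕ → ℚ) → ℚ
  S ψ I = sumℚ (map (λ a → ψ a * I a) R)
  corner : ℚ
  corner = cornerWeight n κ * ind (k x ≡ᵇ n ∸ κ)

P-s₁₂-invariant : ∀ n κ x → P n κ (act s₁₂ x) ≡ P n κ x
P-s₁₂-invariant n κ x = trans (P≈separable n κ (act s₁₂ x))
  (trans (separable-s₁₂ (coeffX n κ) (coeffZ n κ) x) (sym (P≈separable n κ x)))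

-- With n = 2κ+3+d the coefficients vanish for t ≤ κ (region below), coeffX is supported on the
-- d + 2 indices κ < t < n − κ (inside), and above that only the corner term of coeffZ at top = n − κ remains.
module Coefficients (κ d : ℕ) where

  N top : ℕ
  N = 2 ℕ.* κ ℕ.+ 3 ℕ.+ d
  top = 2 ℕ.+ d ℕ.+ suc κ

  N≡top+κ : N ≡ top ℕ.+ κ
  N≡top+κ = shape κ d
    where
    shape : ∀ κ d → 2 ℕ.* κ ℕ.+ 3 ℕ.+ d ≡ 2 ℕ.+ d ℕ.+ suc κ ℕ.+ κ
    shape = solve-∀

  N∸κ≡top : N ∸ κ ≡ top
  N∸κ≡top = trans (cong (_∸ κ) N≡top+κ) (ℕ.m+n∸n≡m top κ)

  N∸2κ≡3+d : N ∸ 2 ℕ.* κ ≡ 3 ℕ.+ d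
  N∸2κ≡3+d = trans (cong (_∸ 2 ℕ.* κ) (ℕ.+-assoc (2 ℕ.* κ) 3 d)) (ℕ.m+n∸m≡n (2 ℕ.* κ) (3 ℕ.+ d))

  mirror-below : ∀ {t} → t ≤ κ → N ∸ t ≡ κ ∸ t ℕ.+ top
  mirror-below {t} t≤κ = trans (cong (_∸ t) N≡top+κ) (trans (ℕ.+-∸-assoc top t≤κ) (ℕ.+-comm top (κ ∸ t)))

  mirror-inside : ∀ {u w} → u ℕ.+ w ≡ suc d → N ∸ (u ℕ.+ suc κ) ≡ w ℕ.+ suc κ
  mirror-inside {u} {w} u+w≡1+d = trans (cong (_∸ (u ℕ.+ suc κ)) N≡) (ℕ.m+n∸m≡n (u ℕ.+ suc κ) (w ℕ.+ suc κ))
    where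
    shape₁ : ∀ κ d → 2 ℕ.* κ ℕ.+ 3 ℕ.+ d ≡ suc d ℕ.+ suc κ ℕ.+ suc κ
    shape₁ = solve-∀
    shape₂ : ∀ u w c → u ℕ.+ w ℕ.+ c ℕ.+ c ≡ u ℕ.+ c ℕ.+ (w ℕ.+ c)
    shape₂ = solve-∀
    N≡ : N ≡ u ℕ.+ suc κ ℕ.+ (w ℕ.+ suc κ)
    N≡ = trans (shape₁ κ d) (trans (cong (λ e → e ℕ.+ suc κ ℕ.+ suc κ) (sym u+w≡1+d)) (shape₂ u w (suc κ)))

  mirror-above : ∀ {v} → v ℕ.+ top ≤ N → v ≤ κ × N ∸ (v ℕ.+ top) ≡ κ ∸ v
  mirror-above {v} v+top≤N = v≤κ , trans (cong (_∸ (v ℕ.+ top)) N≡) (ℕ.m+n∸m≡n (v ℕ.+ top) (κ ∸ v))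
    where
    v≤κ : v ≤ κ
    v≤κ = ℕ.+-cancelˡ-≤ top v κ (subst₂ _≤_ (ℕ.+-comm v top) N≡top+κ v+top≤N)
    shape : ∀ t v x → t ℕ.+ (v ℕ.+ x) ≡ v ℕ.+ t ℕ.+ x
    shape = solve-∀
    N≡ : N ≡ v ℕ.+ top ℕ.+ (κ ∸ v)
    N≡ = trans N≡top+κ (trans (cong (top ℕ.+_) (sym (ℕ.m+[n∸m]≡n v≤κ))) (shape top v (κ ∸ v)))

  data Region : ℕ → Set where
    below  : ∀ {t} → t ≤ κ → Region t
    inside : ∀ u → u < 2 ℕ.+ d → Region (u ℕ.+ suc κ)
    above  : ∀ v → Region (v ℕ.+ top)

  region : ∀ t → Region t
  region t with t ℕ.≤? κ
  ... | yes t≤κ = below t≤κ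
  ... | no  t≰κ = subst Region (ℕ.m∸n+n≡m (ℕ.≰⇒> t≰κ)) (beyond (t ∸ suc κ))
    where
    beyond : ∀ u → Region (u ℕ.+ suc κ)
    beyond u with u ℕ.<? 2 ℕ.+ d
    ... | yes u<2+d = inside u u<2+d
    ... | no  u≮2+d = subst (λ s → Region (s ℕ.+ suc κ)) (ℕ.m∸n+n≡m (ℕ.≮⇒≥ u≮2+d))
                        (subst Region (sym (ℕ.+-assoc (u ∸ (2 ℕ.+ d)) (2 ℕ.+ d) (suc κ))) (above (u ∸ (2 ℕ.+ d))))

  -- Opaque: the development below only uses their values, and unfolding the list sums makes type checking very costly.
  opaque
    f g : ℕ → ℚ
    f = coeffX N κ
    g = coeffZ N κ

  F G : ℕ → ℚ
  F = partialSum f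
  G = partialSum g

  K E : ℚ
  K = ℕ→ℚ κ
  E = ℕ→ℚ (suc d)

  support : List ℕ
  support = range (suc κ) (N ∸ κ ∸ 1)

  support≡ : support ≡ map (suc κ ℕ.+_) (upTo (2 ℕ.+ d))
  support≡ = cong (λ L → map (suc κ ℕ.+_) (upTo L))
    (trans (cong (λ m → suc (m ∸ 1) ∸ suc κ) N∸κ≡top) (ℕ.m+n∸n≡m (2 ℕ.+ d) (suc κ)))

  below-support : ∀ {t} → t ≤ κ → ∀ u → t ≢ suc κ ℕ.+ u
  below-support t≤κ u = ℕ.<⇒≢ (s≤s (ℕ.≤-trans t≤κ (ℕ.m≤m+n κ u)))

  above-support : ∀ v u → u < 2 ℕ.+ d → v ℕ.+ top ≢ suc κ ℕ.+ u
  above-support v u u<2+d = ℕ.<⇒≢ (ℕ.<-≤-trans (ℕ.+-monoʳ-< (suc κ) u<2+d)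
    (subst (_≤ v ℕ.+ top) (ℕ.+-comm (2 ℕ.+ d) (suc κ)) (ℕ.m≤n+m top v))) ∘ sym

  opaque
    unfolding f g

    f-below : ∀ {t} → t ≤ κ → f t ≡ 0ℚ
    f-below {t} t≤κ = trans (cong (λ R → restrictTo R (xWeight N) t) support≡)
      (restrictTo-miss (xWeight N) (suc κ) (2 ℕ.+ d) (λ u _ → below-support t≤κ u))

    f-inside : ∀ {u} → u < 2 ℕ.+ d → f (u ℕ.+ suc κ) ≡ ℕ→ℚ 2 * ℕ→ℚ u - E
    f-inside {u} u<2+d = begin
      f (u ℕ.+ suc κ)
        ≡⟨ cong (λ R → restrictTo R (xWeight N) (u ℕ.+ suc κ)) support≡ ⟩
      restrictTo (map (suc κ ℕ.+_) (upTo (2 ℕ.+ d))) (xWeight N) (u ℕ.+ suc κ)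
        ≡⟨ restrictTo-hit (xWeight N) (suc κ) (2 ℕ.+ d) u<2+d ⟩
      ℤ→ℚ (ℤ.+ (2 ℕ.* (suc κ ℕ.+ u)) ℤ.- ℤ.+ N)
        ≡⟨ ℤ→ℚ-- (ℤ.+ (2 ℕ.* (suc κ ℕ.+ u))) (ℤ.+ N) ⟩
      ℕ→ℚ (2 ℕ.* (suc κ ℕ.+ u)) - ℕ→ℚ N
        ≡⟨ ℕ→ℚ-difference (2 ℕ.* (suc κ ℕ.+ u)) N (suc d) (2 ℕ.* u) (shape κ u d) ⟩
      ℕ→ℚ (2 ℕ.* u) - E
        ≡⟨ cong (_- E) (ℕ→ℚ-* 2 u) ⟩
      ℕ→ℚ 2 * ℕ→ℚ u - E ∎
      where
      open ≡-Reasoning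
      shape : ∀ κ u d → 2 ℕ.* (suc κ ℕ.+ u) ℕ.+ suc d ≡ 2 ℕ.* κ ℕ.+ 3 ℕ.+ d ℕ.+ 2 ℕ.* u
      shape = solve-∀

    f-above : ∀ v → f (v ℕ.+ top) ≡ 0ℚ
    f-above v = trans (cong (λ R → restrictTo R (xWeight N) (v ℕ.+ top)) support≡)
      (restrictTo-miss (xWeight N) (suc κ) (2 ℕ.+ d) (above-support v))

    private
      corner-miss : ∀ {t} → t ≢ top → cornerWeight N κ * ind (t ≡ᵇ N ∸ κ) ≡ 0ℚ
      corner-miss t≢top = trans (cong (cornerWeight N κ *_) (ind-≡ᵇ-≢ (λ t≡ → t≢top (trans t≡ N∸κ≡top)))) (ℚ.*-zeroʳ (cornerWeight N κ))

    g-below : ∀ {t} → t ≤ κ → g t ≡ 0ℚ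
    g-below {t} t≤κ = +-zeros (corner-miss (λ t≡top → below-support t≤κ (2 ℕ.+ d) (trans t≡top (ℕ.+-comm (2 ℕ.+ d) (suc κ)))))
      (trans (cong (λ R → restrictTo R (zWeight κ) t) support≡) (restrictTo-miss (zWeight κ) (suc κ) (2 ℕ.+ d) (λ u _ → below-support t≤κ u)))

    g-inside : ∀ {u} → u < 2 ℕ.+ d → g (u ℕ.+ suc κ) ≡ ℕ→ℚ 2 * ℕ→ℚ u
    g-inside {u} u<2+d = begin
      cornerWeight N κ * ind (u ℕ.+ suc κ ≡ᵇ N ∸ κ) + restrictTo support (zWeight κ) (u ℕ.+ suc κ)
        ≡⟨ cong₂ _+_ (corner-miss (ℕ.<⇒≢ (ℕ.+-monoˡ-< (suc κ) u<2+d)))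
                     (trans (cong (λ R → restrictTo R (zWeight κ) (u ℕ.+ suc κ)) support≡) (restrictTo-hit (zWeight κ) (suc κ) (2 ℕ.+ d) u<2+d)) ⟩
      0ℚ + ℕ→ℚ (2 ℕ.* (suc κ ℕ.+ u ∸ κ ∸ 1))
        ≡⟨ ℚ.+-identityˡ _ ⟩
      ℕ→ℚ (2 ℕ.* (suc κ ℕ.+ u ∸ κ ∸ 1))
        ≡⟨ cong (λ m → ℕ→ℚ (2 ℕ.* m)) (offset κ) ⟩
      ℕ→ℚ (2 ℕ.* u)
        ≡⟨ ℕ→ℚ-* 2 u ⟩
      ℕ→ℚ 2 * ℕ→ℚ u ∎
      where
      open ≡-Reasoning
      offset : ∀ κ → suc κ ℕ.+ u ∸ κ ∸ 1 ≡ u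
      offset zero    = refl
      offset (suc κ) = offset κ

    g-top : g top ≡ - ℕ→ℚ ((2 ℕ.+ d) ℕ.* (1 ℕ.+ d))
    g-top = begin
      cornerWeight N κ * ind (top ≡ᵇ N ∸ κ) + restrictTo support (zWeight κ) top
        ≡⟨ cong₂ _+_ (cong (cornerWeight N κ *_) (ind-≡ᵇ-≡ (sym N∸κ≡top)))
                     (trans (cong (λ R → restrictTo R (zWeight κ) top) support≡) (restrictTo-miss (zWeight κ) (suc κ) (2 ℕ.+ d) (above-support 0))) ⟩
      cornerWeight N κ * 1ℚ + 0ℚ
        ≡⟨ trans (ℚ.+-identityʳ _) (ℚ.*-identityʳ (cornerWeight N κ)) ⟩
      cornerWeight N κ
        ≡⟨ cong (λ m → - ℕ→ℚ ((m ∸ 1) ℕ.* (m ∸ 2))) N∸2κ≡3+d ⟩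
      - ℕ→ℚ ((2 ℕ.+ d) ℕ.* (1 ℕ.+ d)) ∎
      where open ≡-Reasoning

    g-above-top : ∀ v → g (suc v ℕ.+ top) ≡ 0ℚ
    g-above-top v = +-zeros (corner-miss {suc v ℕ.+ top} (ℕ.<⇒≢ (ℕ.m<n+m top {suc v} (s≤s z≤n)) ∘ sym))
      (trans (cong (λ R → restrictTo R (zWeight κ) (suc v ℕ.+ top)) support≡) (restrictTo-miss (zWeight κ) (suc κ) (2 ℕ.+ d) (above-support (suc v))))

  F-below : ∀ {t} → t ≤ κ → F t ≡ 0ℚ
  F-below {t} t≤κ = ∑-zero f (suc t) (λ u u≤t → f-below (ℕ.≤-trans (ℕ.≤-pred u≤t) t≤κ))

  G-below : ∀ {t} → t ≤ κ → G t ≡ 0ℚ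
  G-below {t} t≤κ = ∑-zero g (suc t) (λ u u≤t → g-below (ℕ.≤-trans (ℕ.≤-pred u≤t) t≤κ))

  F-inside : ∀ u → u < 2 ℕ.+ d → F (u ℕ.+ suc κ) ≡ (ℕ→ℚ u + 1ℚ) * (ℕ→ℚ u - E)
  F-inside zero    u<2+d = begin
    F κ + f (suc κ)                 ≡⟨ cong₂ _+_ (F-below ℕ.≤-refl) (f-inside u<2+d) ⟩
    0ℚ + (ℕ→ℚ 2 * 0ℚ - E)           ≡⟨ solve 1 (λ E → con 0ℚ :+ (con (ℕ→ℚ 2) :* con 0ℚ :- E) := (con 0ℚ :+ con 1ℚ) :* (con 0ℚ :- E)) refl E ⟩
    (0ℚ + 1ℚ) * (0ℚ - E)            ∎
    where open ≡-Reasoning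
  F-inside (suc u) u<2+d = begin
    F (u ℕ.+ suc κ) + f (suc u ℕ.+ suc κ)
      ≡⟨ cong₂ _+_ (F-inside u (ℕ.<-trans (ℕ.n<1+n u) u<2+d)) (f-inside u<2+d) ⟩
    (U + 1ℚ) * (U - E) + (ℕ→ℚ 2 * ℕ→ℚ (suc u) - E)
      ≡⟨ cong (λ V → (U + 1ℚ) * (U - E) + (ℕ→ℚ 2 * V - E)) (ℕ→ℚ-suc u) ⟩
    (U + 1ℚ) * (U - E) + (ℕ→ℚ 2 * (1ℚ + U) - E)
      ≡⟨ solve 2 (λ U E → (U :+ con 1ℚ) :* (U :- E) :+ (con (ℕ→ℚ 2) :* (con 1ℚ :+ U) :- E)
                          := (con 1ℚ :+ U :+ con 1ℚ) :* (con 1ℚ :+ U :- E)) refl U E ⟩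
    (1ℚ + U + 1ℚ) * (1ℚ + U - E)
      ≡⟨ cong (λ V → (V + 1ℚ) * (V - E)) (sym (ℕ→ℚ-suc u)) ⟩
    (ℕ→ℚ (suc u) + 1ℚ) * (ℕ→ℚ (suc u) - E) ∎
    where
    open ≡-Reasoning
    U : ℚ
    U = ℕ→ℚ u

  G-inside : ∀ u → u < 2 ℕ.+ d → G (u ℕ.+ suc κ) ≡ ℕ→ℚ u * (ℕ→ℚ u + 1ℚ)
  G-inside zero    u<2+d = begin
    G κ + g (suc κ)                 ≡⟨ cong₂ _+_ (G-below ℕ.≤-refl) (g-inside u<2+d) ⟩
    0ℚ + ℕ→ℚ 2 * 0ℚ                 ≡⟨ solve 0 (con 0ℚ :+ con (ℕ→ℚ 2) :* con 0ℚ := con 0ℚ :* (con 0ℚ :+ con 1ℚ)) refl ⟩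
    0ℚ * (0ℚ + 1ℚ)                  ∎
    where open ≡-Reasoning
  G-inside (suc u) u<2+d = begin
    G (u ℕ.+ suc κ) + g (suc u ℕ.+ suc κ)
      ≡⟨ cong₂ _+_ (G-inside u (ℕ.<-trans (ℕ.n<1+n u) u<2+d)) (g-inside u<2+d) ⟩
    U * (U + 1ℚ) + ℕ→ℚ 2 * ℕ→ℚ (suc u)
      ≡⟨ cong (λ V → U * (U + 1ℚ) + ℕ→ℚ 2 * V) (ℕ→ℚ-suc u) ⟩
    U * (U + 1ℚ) + ℕ→ℚ 2 * (1ℚ + U)
      ≡⟨ solve 1 (λ U → U :* (U :+ con 1ℚ) :+ con (ℕ→ℚ 2) :* (con 1ℚ :+ U) := (con 1ℚ :+ U) :* (con 1ℚ :+ U :+ con 1ℚ)) refl U ⟩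
    (1ℚ + U) * (1ℚ + U + 1ℚ)
      ≡⟨ cong (λ V → V * (V + 1ℚ)) (sym (ℕ→ℚ-suc u)) ⟩
    ℕ→ℚ (suc u) * (ℕ→ℚ (suc u) + 1ℚ) ∎
    where
    open ≡-Reasoning
    U : ℚ
    U = ℕ→ℚ u

  F-above : ∀ v → F (v ℕ.+ top) ≡ 0ℚ
  F-above zero    = begin
    F (suc d ℕ.+ suc κ) + f top     ≡⟨ cong₂ _+_ (F-inside (suc d) ℕ.≤-refl) (f-above 0) ⟩
    (E + 1ℚ) * (E - E) + 0ℚ         ≡⟨ solve 1 (λ E → (E :+ con 1ℚ) :* (E :- E) :+ con 0ℚ := con 0ℚ) refl E ⟩
    0ℚ                              ∎
    where open ≡-Reasoning
  F-above (suc v) = +-zeros (F-above v) (f-above (suc v))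

  G-above : ∀ v → G (v ℕ.+ top) ≡ 0ℚ
  G-above zero    = begin
    G (suc d ℕ.+ suc κ) + g top                     ≡⟨ cong₂ _+_ (G-inside (suc d) ℕ.≤-refl) g-top ⟩
    E * (E + 1ℚ) + - ℕ→ℚ ((2 ℕ.+ d) ℕ.* (1 ℕ.+ d))  ≡⟨ cong (λ x → E * (E + 1ℚ) + - x) (trans (ℕ→ℚ-* (2 ℕ.+ d) (1 ℕ.+ d))
                                                                                   (cong (_* E) (ℕ→ℚ-suc (suc d)))) ⟩
    E * (E + 1ℚ) + - ((1ℚ + E) * E)                  ≡⟨ solve 1 (λ E → E :* (E :+ con 1ℚ) :+ :- ((con 1ℚ :+ E) :* E) := con 0ℚ) refl E ⟩
    0ℚ                                              ∎
    where open ≡-Reasoning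
  G-above (suc v) = +-zeros (G-above v) (g-above-top v)

  private
    vanish : ∀ {a b x} c → a ≡ 0ℚ → b ≡ 0ℚ → x ≡ 0ℚ → a + b + c * x ≡ 0ℚ
    vanish c refl refl refl = trans (ℚ.+-identityˡ (c * 0ℚ)) (ℚ.*-zeroʳ c)

    vanish-factor : ∀ {a b c} x → a ≡ 0ℚ → b ≡ 0ℚ → c ≡ 0ℚ → a + b + c * x ≡ 0ℚ
    vanish-factor x refl refl refl = trans (ℚ.+-identityˡ (0ℚ * x)) (ℚ.*-zeroˡ x)

    distance-from-κ : ∀ w → ℕ→ℚ (w ℕ.+ suc κ) - K ≡ ℕ→ℚ w + 1ℚ
    distance-from-κ w = begin
      ℕ→ℚ (w ℕ.+ suc κ) - K        ≡⟨ cong (_- K) (trans (ℕ→ℚ-+ w (suc κ)) (cong (ℕ→ℚ w +_) (ℕ→ℚ-suc κ))) ⟩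
      ℕ→ℚ w + (1ℚ + K) - K         ≡⟨ solve 2 (λ W K → W :+ (con 1ℚ :+ K) :- K := W :+ con 1ℚ) refl (ℕ→ℚ w) K ⟩
      ℕ→ℚ w + 1ℚ                   ∎
      where open ≡-Reasoning

    record Mirror (u : ℕ) : Set where
      field
        w      : ℕ
        u+w    : u ℕ.+ w ≡ suc d
        w<2+d  : w < 2 ℕ.+ d

    mirror : ∀ {u} → u < 2 ℕ.+ d → Mirror u
    mirror {u} (s≤s u≤1+d) = record { w = suc d ∸ u ; u+w = ℕ.m+[n∸m]≡n u≤1+d ; w<2+d = s≤s (ℕ.m∸n≤m (suc d) u) }

    E≡ : ∀ {u w} → u ℕ.+ w ≡ suc d → E ≡ ℕ→ℚ u + ℕ→ℚ w
    E≡ {u} {w} u+w = trans (cong ℕ→ℚ (sym u+w)) (ℕ→ℚ-+ u w)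

  row-identity : ∀ t → t ≤ N → F (N ∸ t) + G (N ∸ t) + (ℕ→ℚ (N ∸ t) - K) * f t ≡ 0ℚ
  row-identity t t≤N with region t
  ... | below t≤κ = trans (cong (λ m → F m + G m + (ℕ→ℚ m - K) * f t) (mirror-below t≤κ))
                          (vanish (ℕ→ℚ (κ ∸ t ℕ.+ top) - K) (F-above (κ ∸ t)) (G-above (κ ∸ t)) (f-below t≤κ))
  ... | above v   = let _ , N∸t≡κ∸v = mirror-above {v} t≤N in
                    trans (cong (λ m → F m + G m + (ℕ→ℚ m - K) * f t) N∸t≡κ∸v)
                          (vanish (ℕ→ℚ (κ ∸ v) - K) (F-below (ℕ.m∸n≤m κ v)) (G-below (ℕ.m∸n≤m κ v)) (f-above v))
  ... | inside u u<2+d = begin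
    F (N ∸ t) + G (N ∸ t) + (ℕ→ℚ (N ∸ t) - K) * f t
      ≡⟨ cong (λ m → F m + G m + (ℕ→ℚ m - K) * f t) (mirror-inside {u} u+w) ⟩
    F (w ℕ.+ suc κ) + G (w ℕ.+ suc κ) + (ℕ→ℚ (w ℕ.+ suc κ) - K) * f t
      ≡⟨ cong₂ _+_ (cong₂ _+_ (F-inside w w<2+d) (G-inside w w<2+d)) (cong₂ _*_ (distance-from-κ w) (f-inside u<2+d)) ⟩
    (W + 1ℚ) * (W - E) + W * (W + 1ℚ) + (W + 1ℚ) * (ℕ→ℚ 2 * U - E)
      ≡⟨ cong (λ E → (W + 1ℚ) * (W - E) + W * (W + 1ℚ) + (W + 1ℚ) * (ℕ→ℚ 2 * U - E)) (E≡ {u} u+w) ⟩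
    (W + 1ℚ) * (W - (U + W)) + W * (W + 1ℚ) + (W + 1ℚ) * (ℕ→ℚ 2 * U - (U + W))
      ≡⟨ solve 2 (λ U W → (W :+ con 1ℚ) :* (W :- (U :+ W)) :+ W :* (W :+ con 1ℚ) :+ (W :+ con 1ℚ) :* (con (ℕ→ℚ 2) :* U :- (U :+ W))
                          := con 0ℚ) refl U W ⟩
    0ℚ ∎
    where
    open ≡-Reasoning
    open Mirror (mirror u<2+d)
    U W : ℚ
    U = ℕ→ℚ u
    W = ℕ→ℚ w

  column-identity : ∀ t → t ≤ N → F (N ∸ t) + F (N ∸ t) + (ℕ→ℚ (N ∸ t) - K) * g t ≡ 0ℚ
  column-identity t t≤N with region t
  ... | below t≤κ = trans (cong (λ m → F m + F m + (ℕ→ℚ m - K) * g t) (mirror-below t≤κ))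
                          (vanish (ℕ→ℚ (κ ∸ t ℕ.+ top) - K) (F-above (κ ∸ t)) (F-above (κ ∸ t)) (g-below t≤κ))
  ... | above zero = let _ , N∸t≡κ = mirror-above {0} t≤N in
                    trans (cong (λ m → F m + F m + (ℕ→ℚ m - K) * g t) N∸t≡κ)
                          (vanish-factor (g t) (F-below ℕ.≤-refl) (F-below ℕ.≤-refl) (ℚ.+-inverseʳ K))
  ... | above (suc v) = let _ , N∸t≡κ∸v = mirror-above {suc v} t≤N in
                    trans (cong (λ m → F m + F m + (ℕ→ℚ m - K) * g t) N∸t≡κ∸v)
                          (vanish (ℕ→ℚ (κ ∸ suc v) - K) (F-below (ℕ.m∸n≤m κ (suc v))) (F-below (ℕ.m∸n≤m κ (suc v))) (g-above-top v))
  ... | inside u u<2+d = begin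
    F (N ∸ t) + F (N ∸ t) + (ℕ→ℚ (N ∸ t) - K) * g t
      ≡⟨ cong (λ m → F m + F m + (ℕ→ℚ m - K) * g t) (mirror-inside {u} u+w) ⟩
    F (w ℕ.+ suc κ) + F (w ℕ.+ suc κ) + (ℕ→ℚ (w ℕ.+ suc κ) - K) * g t
      ≡⟨ cong₂ _+_ (cong₂ _+_ (F-inside w w<2+d) (F-inside w w<2+d)) (cong₂ _*_ (distance-from-κ w) (g-inside u<2+d)) ⟩
    (W + 1ℚ) * (W - E) + (W + 1ℚ) * (W - E) + (W + 1ℚ) * (ℕ→ℚ 2 * U)
      ≡⟨ cong (λ E → (W + 1ℚ) * (W - E) + (W + 1ℚ) * (W - E) + (W + 1ℚ) * (ℕ→ℚ 2 * U)) (E≡ {u} u+w) ⟩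
    (W + 1ℚ) * (W - (U + W)) + (W + 1ℚ) * (W - (U + W)) + (W + 1ℚ) * (ℕ→ℚ 2 * U)
      ≡⟨ solve 2 (λ U W → (W :+ con 1ℚ) :* (W :- (U :+ W)) :+ (W :+ con 1ℚ) :* (W :- (U :+ W)) :+ (W :+ con 1ℚ) :* (con (ℕ→ℚ 2) :* U)
                          := con 0ℚ) refl U W ⟩
    0ℚ ∎
    where
    open ≡-Reasoning
    open Mirror (mirror u<2+d)
    U W : ℚ
    U = ℕ→ℚ u
    W = ℕ→ℚ w

  opaque
    unfolding f g

    P≈separable-fg : P N κ ≈ separable f g
    P≈separable-fg = P≈separable N κ

  P-eigenvector : A (P N κ) ≈ ((K - ℕ→ℚ 2) ·V P N κ)
  P-eigenvector y = begin
    A (P N κ) y                           ≡⟨ A-cong P≈separable-fg y ⟩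
    A (separable f g) y                   ≡⟨ separable-eigenvector f g K row-identity column-identity y ⟩
    (K - ℕ→ℚ 2) * separable f g y         ≡⟨ cong ((K - ℕ→ℚ 2) *_) (sym (P≈separable-fg y)) ⟩
    (K - ℕ→ℚ 2) * P N κ y                 ∎
    where open ≡-Reasoning

  corner : Vertex N
  corner = vtx 0 κ top (trans (ℕ.+-comm κ top) (sym N≡top+κ))

  P-corner≢0 : P N κ corner ≢ 0ℚ
  P-corner≢0 P≡0 = ℕ→ℚ-≢0 {(2 ℕ.+ d) ℕ.* (1 ℕ.+ d)} (λ ()) (ℚ.neg-injective (begin
    - ℕ→ℚ ((2 ℕ.+ d) ℕ.* (1 ℕ.+ d))    ≡⟨ sym (trans (cong₂ (λ a b → a + b + g top) (f-below z≤n) (f-below ℕ.≤-refl))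
                                                    (trans (ℚ.+-identityˡ (g top)) g-top)) ⟩
    f 0 + f κ + g top                  ≡⟨ sym (P≈separable-fg corner) ⟩
    P N κ corner                       ≡⟨ P≡0 ⟩
    0ℚ                                 ∎))
    where open ≡-Reasoning

  P-s₁₃-corner : P N κ (act s₁₃ corner) ≡ 0ℚ
  P-s₁₃-corner = trans (P≈separable-fg (act s₁₃ corner)) (+-zeros (+-zeros (f-above 0) (f-below ℕ.≤-refl)) (g-below z≤n))

  P-s₂₃-corner : P N κ (act s₂₃ corner) ≡ 0ℚ
  P-s₂₃-corner = trans (P≈separable-fg (act s₂₃ corner)) (+-zeros (+-zeros (f-below z≤n) (f-above 0)) (g-below ℕ.≤-refl))

proposition2p9 : (n k : ℕ) → 2 ℕ.* k ℕ.+ 3 ≤ n →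
    (¬ (P n k ≈ 0V))
    × (A (P n k) ≈ (ℤ→ℚ (ℤ.+ k ℤ.- ℤ.+ 2) ·V P n k))
    × SpanDimS₃ (λ τ → actV τ (P n k)) 3
proposition2p9 n k 2k+3≤n = subst Proposition (proj₂ split)
  ( (λ P≈0 → P-corner≢0 (P≈0 corner))
  , (λ y → trans (P-eigenvector y) (cong (_* P N k y) (sym (ℤ→ℚ-- (ℤ.+ k) (ℤ.+ 2)))))
  , orbit-span-dimension-3 (P N k) (P-s₁₂-invariant N k) corner P-corner≢0 P-s₁₃-corner P-s₂₃-corner )
  where
  Proposition : ℕ → Set
  Proposition n = (¬ (P n k ≈ 0V)) × (A (P n k) ≈ (ℤ→ℚ (ℤ.+ k ℤ.- ℤ.+ 2) ·V P n k)) × SpanDimS₃ (λ τ → actV τ (P n k)) 3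
  split : Σ ℕ λ d → 2 ℕ.* k ℕ.+ 3 ℕ.+ d ≡ n
  split = ℕ.m≤n⇒∃[o]m+o≡n 2k+3≤n
  open Coefficients k (proj₁ split)
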